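{- Let $i,j,m,\ell$ be odd integers with $3\le m<i\le j<\ell$ and $i+j=m+\ell$. Then \[ N(P_{C_m\vee C_\ell})<N(P_{C_i\vee C_j}). \]
   Context: For a finite simple graph $G$ on vertex set $[n]$, the symmetric edge polytope is $P_G=\operatorname{conv}\{\pm(e_i-e_j):\{i,j\}\in E(G)\}\subset\mathbb{R}^n$, and $N(P)$ is the number of facets of a polytope $P$. $C_m$ is the cycle with $m$ edges, and $G\vee H$ denotes a graph obtained by identifying a vertex of $G$ with a vertex of $H$. -}

module Defs where

open import Data.Nat as ℕ using (ℕ; zero; suc; _∸_; _≡ᵇ_)
open import Data.Bool using (Bool; true; false; if_then_else_)
open import Data.Fin using (Fin; toℕ)
open import Data.List using (List; []; _∷_; _++_; map; upTo; allFin; foldr; concatMap; length; lookup)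
open import Data.Product using (Σ; _×_; _,_; ∃)
open import Data.Rational using (ℚ; 0ℚ; 1ℚ; _+_; _*_; -_; _≤_)
open import Data.Fin.Subset using (Subset; _∈_; _⊆_; ⊤)
open import Function.Bundles using (_⇔_)
open import Function.Definitions using (Injective)
open import Relation.Binary.PropositionalEquality using (_≡_; _≢_)

-- The cycle C_m on vertices 0,1,…,m-1 wedged at vertex 0 with the
-- cycle C_ℓ on vertices 0,m,m+1,…,m+ℓ-2.  Total m + ℓ - 1 vertices.
wedgeVertices : ℕ → ℕ → ℕ
wedgeVertices m ℓ = m ℕ.+ ℓ ∸ 1

wedgeEdges : ℕ → ℕ → List (ℕ × ℕ)
wedgeEdges m ℓ =
     map (λ k → (k , suc k)) (upTo (m ∸ 1))
  ++ ((m ∸ 1 , 0) ∷ [])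
  ++ ((0 , m) ∷ [])
  ++ map (λ k → (m ℕ.+ k , suc (m ℕ.+ k))) (upTo (ℓ ∸ 2))
  ++ ((m ℕ.+ ℓ ∸ 2 , 0) ∷ [])

Point : ℕ → Set
Point n = Fin n → ℚ

δ : ℕ → ℕ → ℚ
δ a b = if a ≡ᵇ b then 1ℚ else 0ℚ

edgeVec : (n : ℕ) → ℕ × ℕ → Point n
edgeVec n (i , j) k = δ (toℕ k) i + (- δ (toℕ k) j)

negP : {n : ℕ} → Point n → Point n
negP v k = - v k

-- the list of points ±(e_i - e_j), {i,j} ∈ E(G); P_G is their convex hull
sepPoints : (n : ℕ) → List (ℕ × ℕ) → List (Point n)
sepPoints n E = concatMap (λ e → edgeVec n e ∷ negP (edgeVec n e) ∷ []) E

dot : {n : ℕ} → Point n → Point n → ℚ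
dot {n} a v = foldr (λ k s → a k * v k + s) 0ℚ (allFin n)

-- Faces of P = conv S for a finite list S of points, recorded by the
-- set of indices of points of S lying in the face.

IsFace : {n : ℕ} (S : List (Point n)) → Subset (length S) → Set
IsFace {n} S F =
  Σ (Point n) λ a → Σ ℚ λ b →
    (∀ i → dot a (lookup S i) ≤ b) ×
    (∀ i → (i ∈ F) ⇔ (dot a (lookup S i) ≡ b))

IsFacet : {n : ℕ} (S : List (Point n)) → Subset (length S) → Set
IsFacet S F =
  IsFace S F × F ≢ ⊤ ×
  (∀ G → IsFace S G → G ≢ ⊤ → F ⊆ G → G ≡ F)

NumFacets : {n : ℕ} (S : List (Point n)) → ℕ → Set
NumFacets S k =
  Σ (Fin k → Subset (length S)) λ f →
    Injective _≡_ _≡_ f × (∀ i → IsFacet S (f i)) ×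
    (∀ F → IsFacet S F → ∃ λ i → f i ≡ F)

wedgePoints : (m ℓ : ℕ) → List (Point (wedgeVertices m ℓ))
wedgePoints m ℓ = sepPoints (wedgeVertices m ℓ) (wedgeEdges m ℓ)

-- Write m = 2μ+1 and ℓ = 2ν+1. A facet of the symmetric edge polytope of C_m ∨ C_ℓ is cut out by a
-- functional a attaining its maximum b > 0 on the points ±(e_u − e_v). The edge values a_u − a_v sum
-- to zero around each cycle, so a cycle of length 2k+1 has at most k edges of value b and at most k
-- of value −b; maximality forces exactly k of each, the value on the remaining edge being fixed by
-- the zero-sum condition. Hence facets correspond bijectively to pairs of sign vectors with k pluses,
-- k minuses and one zero on each cycle, and N(P_{C_m ∨ C_ℓ}) = g(μ) g(ν) with g(k) = (2k+1)!/(k!)².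
-- Since g(k+1)/g(k) = (4k+6)/(k+1) is decreasing, g is strictly log-concave, so moving μ and ν
-- towards each other with fixed sum strictly increases g(μ) g(ν).

module Submission where

open import Defs

open import Data.Bool using (Bool; true; false)
open import Data.Empty using (⊥; ⊥-elim)
open import Data.Fin using (Fin; zero; suc; toℕ)
open import Data.List using (List; []; _∷_; _++_; _∷ʳ_; map; length; lookup)
open import Data.Nat as ℕ using (ℕ; zero; suc; z≤n; s≤s)
import Data.Nat.Properties as ℕP
open import Data.Product using (Σ; _×_; _,_; proj₁; proj₂)
open import Data.Rational using (ℚ; 0ℚ; 1ℚ)
import Data.Rational.Properties as ℚP
open import Function using (_∘_)
open import Relation.Binary.PropositionalEquality
open import Relation.Nullary using (yes; no; ¬_; does)

module Lists where

  open import Data.List using (applyUpTo; cartesianProduct)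
  open import Data.List.Properties using (length-map; length-++)
  open import Data.List.Membership.Propositional.Properties using (∈-lookup)
  open import Data.List.Relation.Binary.Pointwise using (Pointwise; []; _∷_)
  open import Data.List.Relation.Unary.All as All using (All; []; _∷_)
  open import Data.List.Relation.Unary.AllPairs using (_∷_)
  open import Data.List.Relation.Unary.Unique.Propositional using (Unique)

  nth : {A : Set} → A → List A → ℕ → A
  nth d []       t       = d
  nth d (x ∷ xs) zero    = x
  nth d (x ∷ xs) (suc t) = nth d xs t

  applyUpTo-cong : {A : Set} {f g : ℕ → A} (r : ℕ) →
    (∀ {k} → k ℕ.< r → f k ≡ g k) → applyUpTo f r ≡ applyUpTo g r
  applyUpTo-cong zero    f≗g = refl
  applyUpTo-cong (suc r) f≗g = cong₂ _∷_ (f≗g (s≤s z≤n)) (applyUpTo-cong r (f≗g ∘ s≤s))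

  applyUpTo-nth : {A : Set} (d : A) (X : List A) {r : ℕ} → length X ≡ r → applyUpTo (nth d X) r ≡ X
  applyUpTo-nth d []      refl = refl
  applyUpTo-nth d (x ∷ X) refl = cong (x ∷_) (applyUpTo-nth d X refl)

  module _ {A B : Set} {R : A → B → Set} where

    Pointwise-nth : {xs : List A} {ys : List B} → Pointwise R xs ys →
      {d : A} {e : B} {t : ℕ} → t ℕ.< length xs → R (nth d xs t) (nth e ys t)
    Pointwise-nth (r ∷ rs) {t = zero}  _          = r
    Pointwise-nth (r ∷ rs) {t = suc t} (s≤s t<xs) = Pointwise-nth rs t<xs

    Pointwise-from-nth : {xs : List A} {ys : List B} {d : A} {e : B} → length xs ≡ length ys →
      (∀ {t} → t ℕ.< length xs → R (nth d xs t) (nth e ys t)) → Pointwise R xs ys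
    Pointwise-from-nth {[]}     {[]}     _   _ = []
    Pointwise-from-nth {x ∷ xs} {y ∷ ys} len r =
      r (s≤s z≤n) ∷ Pointwise-from-nth (ℕP.suc-injective len) (λ t<xs → r (s≤s t<xs))

    Pointwise-++⁻ : (xs : List A) {ys : List B} {xs′ : List A} {ys′ : List B} → length xs ≡ length ys →
      Pointwise R (xs ++ xs′) (ys ++ ys′) → Pointwise R xs ys × Pointwise R xs′ ys′
    Pointwise-++⁻ []       {[]}     _   rs       = [] , rs
    Pointwise-++⁻ (x ∷ xs) {y ∷ ys} len (r ∷ rs) =
      let (rs₁ , rs₂) = Pointwise-++⁻ xs (ℕP.suc-injective len) rs in r ∷ rs₁ , rs₂

  module _ {A : Set} {P : A → Set} where

    All-from-nth : (xs : List A) {d : A} → (∀ {t} → t ℕ.< length xs → P (nth d xs t)) → All P xs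
    All-from-nth []       _ = []
    All-from-nth (x ∷ xs) p = p (s≤s z≤n) ∷ All-from-nth xs (λ t<xs → p (s≤s t<xs))

  nth-map : {A B : Set} (f : A → B) {d : A} (xs : List A) (t : ℕ) → nth (f d) (map f xs) t ≡ f (nth d xs t)
  nth-map f []       t       = refl
  nth-map f (x ∷ xs) zero    = refl
  nth-map f (x ∷ xs) (suc t) = nth-map f xs t

  length-cartesianProduct : {A B : Set} (xs : List A) (ys : List B) →
    length (cartesianProduct xs ys) ≡ length xs ℕ.* length ys
  length-cartesianProduct []       ys = refl
  length-cartesianProduct (x ∷ xs) ys = trans (length-++ (map (x ,_) ys))
    (cong₂ ℕ._+_ (length-map (x ,_) ys) (length-cartesianProduct xs ys))

  lookup-injective : {A : Set} {xs : List A} → Unique xs → ∀ i j → lookup xs i ≡ lookup xs j → i ≡ j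
  lookup-injective (x∉ ∷ xs!) zero    zero    _  = refl
  lookup-injective (x∉ ∷ xs!) zero    (suc j) eq = ⊥-elim (All.lookup x∉ (∈-lookup j) eq)
  lookup-injective (x∉ ∷ xs!) (suc i) zero    eq = ⊥-elim (All.lookup x∉ (∈-lookup i) (sym eq))
  lookup-injective (x∉ ∷ xs!) (suc i) (suc j) eq = cong suc (lookup-injective xs! i j eq)

module EdgeValues where

  open Lists using (nth)

  open import Algebra.Properties.CommutativeMonoid.Sum ℚP.+-0-commutativeMonoid
    using (sum; ∑-distrib-+; sum-cong-≗; sum-replicate-zero)
  open import Data.List using (foldr; tabulate; applyUpTo)
  open import Data.Rational using (_+_; _*_; -_; _-_)
  open import Data.Rational.Properties
    using (+-*-commutativeRing; _≟_; +-identityˡ; +-identityʳ; +-assoc; +-inverseʳ; neg-distrib-+;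
           *-identityʳ; *-zeroʳ; *-distribˡ-+; neg-distribʳ-*)
  open import Level using (0ℓ)
  open import Relation.Nullary.Decidable using (dec⇒maybe)
  open import Tactic.RingSolver using (solve-∀)
  open import Tactic.RingSolver.Core.AlmostCommutativeRing
    using (AlmostCommutativeRing; fromCommutativeRing)

  ℚ-ring : AlmostCommutativeRing 0ℓ 0ℓ
  ℚ-ring = fromCommutativeRing +-*-commutativeRing (λ x → dec⇒maybe (0ℚ ≟ x))

  sumℚ : List ℚ → ℚ
  sumℚ = foldr _+_ 0ℚ

  sumℚ-++ : (xs ys : List ℚ) → sumℚ (xs ++ ys) ≡ sumℚ xs + sumℚ ys
  sumℚ-++ []       ys = sym (+-identityˡ (sumℚ ys))
  sumℚ-++ (x ∷ xs) ys = trans (cong (x +_) (sumℚ-++ xs ys)) (sym (+-assoc x (sumℚ xs) (sumℚ ys)))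

  sumℚ-neg : (xs : List ℚ) → sumℚ (map -_ xs) ≡ - sumℚ xs
  sumℚ-neg []       = refl
  sumℚ-neg (x ∷ xs) = trans (cong (- x +_) (sumℚ-neg xs)) (sym (neg-distrib-+ x (sumℚ xs)))

  sumℚ-telescope : (f : ℕ → ℚ) (r : ℕ) →
    sumℚ (applyUpTo (λ k → f k - f (suc k)) r) ≡ f 0 - f r
  sumℚ-telescope f zero    = sym (+-inverseʳ (f 0))
  sumℚ-telescope f (suc r) = trans (cong (f 0 - f 1 +_) (sumℚ-telescope (f ∘ suc) r))
    (cancel (f 0) (f 1) (f (suc r)))
    where
    cancel : ∀ x y z → (x - y) + (y - z) ≡ x - z
    cancel = solve-∀ ℚ-ring

  -- Labels u ≥ n have coordinate 0.
  coord : {n : ℕ} → Point n → ℕ → ℚ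
  coord {zero}  a u       = 0ℚ
  coord {suc n} a zero    = a zero
  coord {suc n} a (suc u) = coord (a ∘ suc) u

  coord-< : (n : ℕ) (φ : ℕ → ℚ) {u : ℕ} → u ℕ.< n → coord {n} (φ ∘ toℕ) u ≡ φ u
  coord-< (suc n) φ {zero}  _         = refl
  coord-< (suc n) φ {suc u} (s≤s u<n) = coord-< n (φ ∘ suc) u<n

  sum-neg : {n : ℕ} (f : Fin n → ℚ) → sum (λ k → - f k) ≡ - sum f
  sum-neg {zero}  f = refl
  sum-neg {suc n} f = trans (cong (- f zero +_) (sum-neg (f ∘ suc)))
    (sym (neg-distrib-+ (f zero) (sum (f ∘ suc))))

  foldr-tabulate : {n N : ℕ} (h : Fin N → ℚ) (g : Fin n → Fin N) →
    foldr (λ k s → h k + s) 0ℚ (tabulate g) ≡ sum (h ∘ g)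
  foldr-tabulate {zero}  h g = refl
  foldr-tabulate {suc n} h g = cong (h (g zero) +_) (foldr-tabulate h (g ∘ suc))

  dot-sum : {n : ℕ} (a v : Point n) → dot a v ≡ sum (λ k → a k * v k)
  dot-sum a v = foldr-tabulate (λ k → a k * v k) (λ k → k)

  sum-δ : {n : ℕ} (a : Point n) (u : ℕ) → sum (λ k → a k * δ (toℕ k) u) ≡ coord a u
  sum-δ {zero}  a u       = refl
  sum-δ {suc n} a zero    = begin
    a zero * 1ℚ + sum (λ k → a (suc k) * 0ℚ)  ≡⟨ cong₂ _+_ (*-identityʳ (a zero))
                                                    (sum-cong-≗ (λ k → *-zeroʳ (a (suc k)))) ⟩
    a zero + sum {n} (λ _ → 0ℚ)               ≡⟨ cong (a zero +_) (sum-replicate-zero n) ⟩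
    a zero + 0ℚ                                ≡⟨ +-identityʳ (a zero) ⟩
    a zero                                     ∎
    where open ≡-Reasoning
  sum-δ {suc n} a (suc u) =
    trans (cong (_+ sum (λ k → a (suc k) * δ (toℕ k) u)) (*-zeroʳ (a zero)))
          (trans (+-identityˡ _) (sum-δ (a ∘ suc) u))

  edgeValue : {n : ℕ} → Point n → ℕ × ℕ → ℚ
  edgeValue a (u , v) = coord a u - coord a v

  edgeValues : {n : ℕ} → Point n → List (ℕ × ℕ) → List ℚ
  edgeValues a = map (edgeValue a)

  dot-negP : {n : ℕ} (a v : Point n) → dot a (negP v) ≡ - dot a v
  dot-negP a v = begin
    dot a (negP v)             ≡⟨ dot-sum a (negP v) ⟩
    sum (λ k → a k * - v k)    ≡⟨ sum-cong-≗ (λ k → sym (neg-distribʳ-* (a k) (v k))) ⟩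
    sum (λ k → - (a k * v k))  ≡⟨ sum-neg (λ k → a k * v k) ⟩
    - sum (λ k → a k * v k)    ≡⟨ cong -_ (dot-sum a v) ⟨
    - dot a v                  ∎
    where open ≡-Reasoning

  dot-edgeVec : {n : ℕ} (a : Point n) (e : ℕ × ℕ) → dot a (edgeVec n e) ≡ edgeValue a e
  dot-edgeVec {n} a (u , v) = begin
    dot a (edgeVec n (u , v))
      ≡⟨ dot-sum a (edgeVec n (u , v)) ⟩
    sum (λ k → a k * (δ (toℕ k) u - δ (toℕ k) v))
      ≡⟨ sum-cong-≗ (λ k → *-distribˡ-+ (a k) (δ (toℕ k) u) (- δ (toℕ k) v)) ⟩
    sum (λ k → a k * δ (toℕ k) u + a k * - δ (toℕ k) v)
      ≡⟨ ∑-distrib-+ (λ k → a k * δ (toℕ k) u) (λ k → a k * - δ (toℕ k) v) ⟩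
    sum (λ k → a k * δ (toℕ k) u) + sum (λ k → a k * - δ (toℕ k) v)
      ≡⟨ cong (sum (λ k → a k * δ (toℕ k) u) +_)
              (trans (sum-cong-≗ (λ k → sym (neg-distribʳ-* (a k) (δ (toℕ k) v))))
                     (sum-neg (λ k → a k * δ (toℕ k) v))) ⟩
    sum (λ k → a k * δ (toℕ k) u) - sum (λ k → a k * δ (toℕ k) v)
      ≡⟨ cong₂ _-_ (sum-δ a u) (sum-δ a v) ⟩
    edgeValue a (u , v) ∎
    where open ≡-Reasoning

  signed : Bool → ℚ → ℚ
  signed true  x = x
  signed false x = - x

  edgeIndex : {n : ℕ} (E : List (ℕ × ℕ)) → Fin (length (sepPoints n E)) → ℕ
  edgeIndex (e ∷ E) zero          = 0
  edgeIndex (e ∷ E) (suc zero)    = 0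
  edgeIndex (e ∷ E) (suc (suc p)) = suc (edgeIndex E p)

  edgeSign : {n : ℕ} (E : List (ℕ × ℕ)) → Fin (length (sepPoints n E)) → Bool
  edgeSign (e ∷ E) zero          = true
  edgeSign (e ∷ E) (suc zero)    = false
  edgeSign (e ∷ E) (suc (suc p)) = edgeSign E p

  edgeIndex-< : {n : ℕ} (E : List (ℕ × ℕ)) (p : Fin (length (sepPoints n E))) →
    edgeIndex E p ℕ.< length E
  edgeIndex-< (e ∷ E) zero          = s≤s z≤n
  edgeIndex-< (e ∷ E) (suc zero)    = s≤s z≤n
  edgeIndex-< (e ∷ E) (suc (suc p)) = s≤s (edgeIndex-< E p)

  pointOf : {n : ℕ} (E : List (ℕ × ℕ)) (t : ℕ) → Bool → t ℕ.< length E →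
    Fin (length (sepPoints n E))
  pointOf (e ∷ E) zero    true  _         = zero
  pointOf (e ∷ E) zero    false _         = suc zero
  pointOf (e ∷ E) (suc t) σ     (s≤s t<E) = suc (suc (pointOf E t σ t<E))

  edgeIndex-pointOf : {n : ℕ} (E : List (ℕ × ℕ)) (t : ℕ) (σ : Bool) (t<E : t ℕ.< length E) →
    edgeIndex {n} E (pointOf E t σ t<E) ≡ t
  edgeIndex-pointOf (e ∷ E) zero    true  _         = refl
  edgeIndex-pointOf (e ∷ E) zero    false _         = refl
  edgeIndex-pointOf (e ∷ E) (suc t) σ     (s≤s t<E) = cong suc (edgeIndex-pointOf E t σ t<E)

  edgeSign-pointOf : {n : ℕ} (E : List (ℕ × ℕ)) (t : ℕ) (σ : Bool) (t<E : t ℕ.< length E) →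
    edgeSign {n} E (pointOf E t σ t<E) ≡ σ
  edgeSign-pointOf (e ∷ E) zero    true  _         = refl
  edgeSign-pointOf (e ∷ E) zero    false _         = refl
  edgeSign-pointOf (e ∷ E) (suc t) σ     (s≤s t<E) = edgeSign-pointOf E t σ t<E

  dot-sepPoints : {n : ℕ} (a : Point n) (E : List (ℕ × ℕ)) (p : Fin (length (sepPoints n E))) →
    dot a (lookup (sepPoints n E) p) ≡ signed (edgeSign E p) (nth 0ℚ (edgeValues a E) (edgeIndex E p))
  dot-sepPoints     a (e ∷ E) zero          = dot-edgeVec a e
  dot-sepPoints {n} a (e ∷ E) (suc zero)    = trans (dot-negP a (edgeVec n e)) (cong -_ (dot-edgeVec a e))
  dot-sepPoints     a (e ∷ E) (suc (suc p)) = dot-sepPoints a E p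

  dot-pointOf : {n : ℕ} (a : Point n) (E : List (ℕ × ℕ)) (t : ℕ) (σ : Bool) (t<E : t ℕ.< length E) →
    dot a (lookup (sepPoints n E) (pointOf E t σ t<E)) ≡ signed σ (nth 0ℚ (edgeValues a E) t)
  dot-pointOf a E t σ t<E = trans (dot-sepPoints a E (pointOf E t σ t<E))
    (cong₂ (λ σ′ t′ → signed σ′ (nth 0ℚ (edgeValues a E) t′))
           (edgeSign-pointOf E t σ t<E) (edgeIndex-pointOf E t σ t<E))

module LevelSets where

  open import Data.Fin.Subset using (Subset; _∈_; _⊆_; ⊤)
  open import Data.Fin.Subset.Properties using (⊆-antisym; ∈⊤)
  open import Data.Rational using (_*_; _≤_; 1/_; ≢-nonZero)
  open import Data.Rational.Properties using (_≟_; *-assoc; *-identityˡ; *-identityʳ; *-inverseʳ; *-zeroʳ)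
  open import Data.Vec using (tabulate)
  open import Data.Vec.Properties using (lookup∘tabulate; []=⇒lookup; lookup⇒[]=)
  open import Function.Bundles using (mk⇔; Equivalence)
  open import Relation.Nullary.Decidable using (dec-true)

  *-cancelʳ : (x y c : ℚ) → c ≢ 0ℚ → x * c ≡ y * c → x ≡ y
  *-cancelʳ x y c c≢0 eq = begin
    x                  ≡⟨ *-identityʳ x ⟨
    x * 1ℚ             ≡⟨ cong (x *_) (*-inverseʳ c) ⟨
    x * (c * 1/ c)     ≡⟨ *-assoc x c (1/ c) ⟨
    x * c * 1/ c       ≡⟨ cong (_* 1/ c) eq ⟩
    y * c * 1/ c       ≡⟨ *-assoc y c (1/ c) ⟩
    y * (c * 1/ c)     ≡⟨ cong (y *_) (*-inverseʳ c) ⟩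
    y * 1ℚ             ≡⟨ *-identityʳ y ⟩
    y                  ∎
    where
    open ≡-Reasoning
    instance _ = ≢-nonZero c≢0

  ∈-tabulate⁻ : {k : ℕ} (f : Fin k → Bool) {p : Fin k} → p ∈ tabulate f → f p ≡ true
  ∈-tabulate⁻ f {p} p∈ = trans (sym (lookup∘tabulate f p)) ([]=⇒lookup p∈)

  ∈-tabulate⁺ : {k : ℕ} (f : Fin k → Bool) {p : Fin k} → f p ≡ true → p ∈ tabulate f
  ∈-tabulate⁺ f {p} fp = lookup⇒[]= p (tabulate f) (trans (lookup∘tabulate f p) fp)

  levelSet : {n : ℕ} (S : List (Point n)) → Point n → ℚ → Subset (length S)
  levelSet S a b = tabulate (λ p → does (dot a (lookup S p) ≟ b))

  module _ {n : ℕ} (S : List (Point n)) (a : Point n) (b : ℚ) where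

    ∈-levelSet⁻ : {p : Fin (length S)} → p ∈ levelSet S a b → dot a (lookup S p) ≡ b
    ∈-levelSet⁻ {p} p∈ with dot a (lookup S p) ≟ b | ∈-tabulate⁻ _ p∈
    ... | yes eq | _ = eq

    ∈-levelSet⁺ : {p : Fin (length S)} → dot a (lookup S p) ≡ b → p ∈ levelSet S a b
    ∈-levelSet⁺ {p} eq = ∈-tabulate⁺ _ (dec-true (dot a (lookup S p) ≟ b) eq)

    levelSet-isFace : (∀ p → dot a (lookup S p) ≤ b) → IsFace S (levelSet S a b)
    levelSet-isFace bounded = a , b , bounded , λ p → mk⇔ ∈-levelSet⁻ ∈-levelSet⁺

    levelSet≡⊤ : (∀ p → dot a (lookup S p) ≡ b) → levelSet S a b ≡ ⊤
    levelSet≡⊤ attained = ⊆-antisym (λ _ → ∈⊤) (λ {p} _ → ∈-levelSet⁺ (attained p))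

  isFace⇒levelSet : {n : ℕ} (S : List (Point n)) {F : Subset (length S)} → IsFace S F →
    Σ (Point n) λ a → Σ ℚ λ b → (∀ p → dot a (lookup S p) ≤ b) × F ≡ levelSet S a b
  isFace⇒levelSet S (a , b , bounded , F⇔) = a , b , bounded ,
    ⊆-antisym (λ p∈F → ∈-levelSet⁺ S a b (Equivalence.to (F⇔ _) p∈F))
              (λ p∈L → Equivalence.from (F⇔ _) (∈-levelSet⁻ S a b p∈L))

  levelSet-scale : {n : ℕ} (S : List (Point n)) (a a′ : Point n) {c : ℚ} → c ≢ 0ℚ →
    (∀ p → dot a′ (lookup S p) ≡ dot a (lookup S p) * c) → levelSet S a′ c ≡ levelSet S a 1ℚ
  levelSet-scale S a a′ {c} c≢0 scaled = ⊆-antisym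
    (λ p∈ → ∈-levelSet⁺ S a 1ℚ
      (*-cancelʳ _ 1ℚ c c≢0 (trans (sym (scaled _)) (trans (∈-levelSet⁻ S a′ c p∈) (sym (*-identityˡ c))))))
    (λ p∈ → ∈-levelSet⁺ S a′ c
      (trans (scaled _) (trans (cong (_* c) (∈-levelSet⁻ S a 1ℚ p∈)) (*-identityˡ c))))

  levelSet-proportional : {n : ℕ} (S : List (Point n)) (a a′ : Point n) {c : ℚ} →
    (∀ p → dot a′ (lookup S p) ≡ dot a (lookup S p) * c) → ¬ levelSet S a′ c ≡ ⊤ →
    levelSet S a′ c ≡ levelSet S a 1ℚ
  levelSet-proportional S a a′ {c} scaled ≢⊤ with c ≟ 0ℚ
  ... | yes refl = ⊥-elim (≢⊤ (levelSet≡⊤ S a′ 0ℚ (λ p → trans (scaled p) (*-zeroʳ (dot a (lookup S p))))))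
  ... | no  c≢0  = levelSet-scale S a a′ c≢0 scaled

module Circulations where

  open Lists
  open EdgeValues

  open import Data.List using (applyUpTo)
  open import Data.List.Properties
    using (map-++; ++-assoc; length-map; length-++; map-upTo; map-applyUpTo; applyUpTo-∷ʳ; length-applyUpTo)
  open import Data.Nat using (_∸_; _≤?_)
  open import Data.Rational using (_+_; -_; _-_)
  open import Data.Rational.Properties using (+-identityʳ; +-identityˡ; +-assoc; neg-distrib-+)
  open import Tactic.RingSolver using (solve-∀)

  Circulation : ℕ → List ℚ → Set
  Circulation k X = length X ≡ k × sumℚ X ≡ 0ℚ

  consecutive : ℕ → ℕ → List (ℕ × ℕ)
  consecutive s r = applyUpTo (λ k → (s ℕ.+ k , suc (s ℕ.+ k))) r

  cycle₁ : ℕ → List (ℕ × ℕ)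
  cycle₁ m′ = consecutive 0 m′ ++ (m′ , 0) ∷ []

  cycle₂ : ℕ → ℕ → List (ℕ × ℕ)
  cycle₂ m′ l = (0 , suc m′) ∷ consecutive (suc m′) l ++ (suc m′ ℕ.+ l , 0) ∷ []

  wedgeEdges-cycles : (m′ l : ℕ) → wedgeEdges (suc m′) (suc (suc l)) ≡ cycle₁ m′ ++ cycle₂ m′ l
  wedgeEdges-cycles m′ l = begin
    wedgeEdges (suc m′) (suc (suc l))
      ≡⟨ cong₂ (λ P Q → P ++ (m′ , 0) ∷ (0 , suc m′) ∷ Q ++ (last , 0) ∷ [])
               (map-upTo _ m′) (map-upTo _ l) ⟩
    consecutive 0 m′ ++ (m′ , 0) ∷ (0 , suc m′) ∷ consecutive (suc m′) l ++ (last , 0) ∷ []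
      ≡⟨ cong (λ v → consecutive 0 m′ ++ (m′ , 0) ∷ (0 , suc m′) ∷ consecutive (suc m′) l ++ (v , 0) ∷ [])
              (trans (cong (_∸ 1) (ℕP.+-suc m′ (suc l))) (ℕP.+-suc m′ l)) ⟩
    consecutive 0 m′ ++ (m′ , 0) ∷ cycle₂ m′ l
      ≡⟨ ++-assoc (consecutive 0 m′) ((m′ , 0) ∷ []) (cycle₂ m′ l) ⟨
    cycle₁ m′ ++ cycle₂ m′ l ∎
    where
    open ≡-Reasoning
    last = suc m′ ℕ.+ suc (suc l) ∸ 2

  length-snoc-consecutive : (s r : ℕ) (e : ℕ × ℕ) → length (consecutive s r ++ e ∷ []) ≡ suc r
  length-snoc-consecutive s r e =
    trans (length-++ (consecutive s r)) (trans (ℕP.+-comm (length (consecutive s r)) 1)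
                                               (cong suc (length-applyUpTo _ r)))

  length-cycle₁ : (m′ : ℕ) → length (cycle₁ m′) ≡ suc m′
  length-cycle₁ m′ = length-snoc-consecutive 0 m′ (m′ , 0)

  length-cycle₂ : (m′ l : ℕ) → length (cycle₂ m′ l) ≡ suc (suc l)
  length-cycle₂ m′ l = cong suc (length-snoc-consecutive (suc m′) l (suc m′ ℕ.+ l , 0))

  module _ {n : ℕ} (a : Point n) where

    edgeValues-consecutive : (s r : ℕ) →
      edgeValues a (consecutive s r) ≡ applyUpTo (λ k → coord a (s ℕ.+ k) - coord a (s ℕ.+ suc k)) r
    edgeValues-consecutive s r = trans (map-applyUpTo _ (edgeValue a) r)
      (applyUpTo-cong r (λ {k} _ → cong (λ v → coord a (s ℕ.+ k) - coord a v) (sym (ℕP.+-suc s k))))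

    sumℚ-consecutive : (s r : ℕ) → sumℚ (edgeValues a (consecutive s r)) ≡ coord a s - coord a (s ℕ.+ r)
    sumℚ-consecutive s r = begin
      sumℚ (edgeValues a (consecutive s r))    ≡⟨ cong sumℚ (edgeValues-consecutive s r) ⟩
      sumℚ (applyUpTo (λ k → f k - f (suc k)) r) ≡⟨ sumℚ-telescope f r ⟩
      f 0 - f r                                ≡⟨ cong (λ u → coord a u - f r) (ℕP.+-identityʳ s) ⟩
      coord a s - coord a (s ℕ.+ r)            ∎
      where
      open ≡-Reasoning
      f : ℕ → ℚ
      f k = coord a (s ℕ.+ k)

    circulation-cycle₁ : (m′ : ℕ) → Circulation (suc m′) (edgeValues a (cycle₁ m′))
    circulation-cycle₁ m′ = trans (length-map (edgeValue a) (cycle₁ m′)) (length-cycle₁ m′) , sum-cycle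
      where
      closed : ∀ x y → (x - y) + ((y - x) + 0ℚ) ≡ 0ℚ
      closed = solve-∀ ℚ-ring
      sum-cycle : sumℚ (edgeValues a (cycle₁ m′)) ≡ 0ℚ
      sum-cycle = begin
        sumℚ (edgeValues a (cycle₁ m′))
          ≡⟨ cong sumℚ (map-++ (edgeValue a) (consecutive 0 m′) _) ⟩
        sumℚ (edgeValues a (consecutive 0 m′) ++ edgeValue a (m′ , 0) ∷ [])
          ≡⟨ sumℚ-++ (edgeValues a (consecutive 0 m′)) _ ⟩
        sumℚ (edgeValues a (consecutive 0 m′)) + ((coord a m′ - coord a 0) + 0ℚ)
          ≡⟨ cong (_+ ((coord a m′ - coord a 0) + 0ℚ)) (sumℚ-consecutive 0 m′) ⟩
        (coord a 0 - coord a m′) + ((coord a m′ - coord a 0) + 0ℚ)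
          ≡⟨ closed (coord a 0) (coord a m′) ⟩
        0ℚ ∎
        where open ≡-Reasoning

    circulation-cycle₂ : (m′ l : ℕ) → Circulation (suc (suc l)) (edgeValues a (cycle₂ m′ l))
    circulation-cycle₂ m′ l = trans (length-map (edgeValue a) (cycle₂ m′ l)) (length-cycle₂ m′ l) , sum-cycle
      where
      s = suc m′
      closed : ∀ x y z → (x - y) + ((y - z) + ((z - x) + 0ℚ)) ≡ 0ℚ
      closed = solve-∀ ℚ-ring
      sum-cycle : sumℚ (edgeValues a (cycle₂ m′ l)) ≡ 0ℚ
      sum-cycle = begin
        sumℚ (edgeValues a (cycle₂ m′ l))
          ≡⟨ cong (λ V → coord a 0 - coord a s + sumℚ V) (map-++ (edgeValue a) (consecutive s l) _) ⟩
        (coord a 0 - coord a s) + sumℚ (edgeValues a (consecutive s l) ++ edgeValue a (s ℕ.+ l , 0) ∷ [])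
          ≡⟨ cong (coord a 0 - coord a s +_) (sumℚ-++ (edgeValues a (consecutive s l)) _) ⟩
        (coord a 0 - coord a s) + (sumℚ (edgeValues a (consecutive s l)) + ((coord a (s ℕ.+ l) - coord a 0) + 0ℚ))
          ≡⟨ cong (λ x → (coord a 0 - coord a s) + (x + ((coord a (s ℕ.+ l) - coord a 0) + 0ℚ)))
                  (sumℚ-consecutive s l) ⟩
        (coord a 0 - coord a s) + ((coord a s - coord a (s ℕ.+ l)) + ((coord a (s ℕ.+ l) - coord a 0) + 0ℚ))
          ≡⟨ closed (coord a 0) (coord a s) (coord a (s ℕ.+ l)) ⟩
        0ℚ ∎
        where open ≡-Reasoning

    edgeValues-wedge : (m′ l : ℕ) → edgeValues a (wedgeEdges (suc m′) (suc (suc l))) ≡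
      edgeValues a (cycle₁ m′) ++ edgeValues a (cycle₂ m′ l)
    edgeValues-wedge m′ l = trans (cong (edgeValues a) (wedgeEdges-cycles m′ l))
                                  (map-++ (edgeValue a) (cycle₁ m′) (cycle₂ m′ l))

  potential : List ℚ → ℕ → ℚ
  potential X zero    = 0ℚ
  potential X (suc k) = potential X k - nth 0ℚ X k

  potential-step : (X : List ℚ) (k : ℕ) → potential X k - potential X (suc k) ≡ nth 0ℚ X k
  potential-step X k = cancel (potential X k) (nth 0ℚ X k)
    where
    cancel : ∀ p x → p - (p - x) ≡ x
    cancel = solve-∀ ℚ-ring

  potential-∷ : (x : ℚ) (X : List ℚ) (k : ℕ) → potential (x ∷ X) (suc k) ≡ - x + potential X k
  potential-∷ x X zero    = trans (+-identityˡ (- x)) (sym (+-identityʳ (- x)))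
  potential-∷ x X (suc k) = trans (cong (_- nth 0ℚ X k) (potential-∷ x X k))
                                  (+-assoc (- x) (potential X k) (- nth 0ℚ X k))

  potential-length : (X : List ℚ) → potential X (length X) ≡ - sumℚ X
  potential-length []      = refl
  potential-length (x ∷ X) = trans (potential-∷ x X (length X))
    (trans (cong (- x +_) (potential-length X)) (sym (neg-distrib-+ x (sumℚ X))))

  potential-closes : (X : List ℚ) {r : ℕ} → Circulation (suc r) X → potential X r ≡ nth 0ℚ X r
  potential-closes X {r} (|X|≡1+r , ΣX≡0) = begin
    potential X r                       ≡⟨ split (potential X r) (nth 0ℚ X r) ⟩
    potential X (suc r) + nth 0ℚ X r    ≡⟨ cong (λ k → potential X k + nth 0ℚ X r) |X|≡1+r ⟨
    potential X (length X) + nth 0ℚ X r ≡⟨ cong (_+ nth 0ℚ X r) (trans (potential-length X) (cong -_ ΣX≡0)) ⟩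
    0ℚ + nth 0ℚ X r                     ≡⟨ +-identityˡ (nth 0ℚ X r) ⟩
    nth 0ℚ X r                          ∎
    where
    open ≡-Reasoning
    split : ∀ p x → p ≡ (p - x) + x
    split = solve-∀ ℚ-ring

  module _ {n : ℕ} (a : Point n) (X : List ℚ) where

    edgeValue-potential : (k : ℕ) {u v : ℕ} → coord a u ≡ potential X k → coord a v ≡ potential X (suc k) →
      edgeValue a (u , v) ≡ nth 0ℚ X k
    edgeValue-potential k cu cv = trans (cong₂ _-_ cu cv) (potential-step X k)

    edgeValue-closing : {r u v : ℕ} → Circulation (suc r) X →
      coord a u ≡ potential X r → coord a v ≡ 0ℚ → edgeValue a (u , v) ≡ nth 0ℚ X r
    edgeValue-closing circ cu cv =
      trans (cong₂ _-_ cu cv) (trans (+-identityʳ _) (potential-closes X circ))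

  module WedgePoint (m′ l : ℕ) (X₁ X₂ : List ℚ) where

    wedgePotential : ℕ → ℚ
    wedgePotential x with x ≤? m′
    ... | yes _ = potential X₁ x
    ... | no  _ = potential X₂ (x ∸ m′)

    wedgePoint : Point (wedgeVertices (suc m′) (suc (suc l)))
    wedgePoint = wedgePotential ∘ toℕ

    private
      wp : Point (wedgeVertices (suc m′) (suc (suc l)))
      wp = wedgePoint

    coord-cycle₁ : {x : ℕ} → x ℕ.≤ m′ → coord wp x ≡ potential X₁ x
    coord-cycle₁ {x} x≤m′ = trans (coord-< _ wedgePotential x<n) potential₁
      where
      x<n : x ℕ.< m′ ℕ.+ suc (suc l)
      x<n = ℕP.<-≤-trans (s≤s x≤m′)
              (ℕP.≤-trans (ℕP.m≤m+n (suc m′) (suc l)) (ℕP.≤-reflexive (sym (ℕP.+-suc m′ (suc l)))))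
      potential₁ : wedgePotential x ≡ potential X₁ x
      potential₁ with x ≤? m′
      ... | yes _    = refl
      ... | no  x≰m′ = ⊥-elim (x≰m′ x≤m′)

    coord-cycle₂ : {k : ℕ} → k ℕ.≤ l → coord wp (suc m′ ℕ.+ k) ≡ potential X₂ (suc k)
    coord-cycle₂ {k} k≤l = trans (coord-< _ wedgePotential x<n) potential₂
      where
      x = suc m′ ℕ.+ k
      x<n : x ℕ.< m′ ℕ.+ suc (suc l)
      x<n = ℕP.≤-trans (ℕP.≤-reflexive (sym (ℕP.+-suc (suc m′) k)))
              (ℕP.≤-trans (ℕP.+-monoʳ-≤ (suc m′) (s≤s k≤l)) (ℕP.≤-reflexive (sym (ℕP.+-suc m′ (suc l)))))
      potential₂ : wedgePotential x ≡ potential X₂ (suc k)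
      potential₂ with x ≤? m′
      ... | yes x≤m′ = ⊥-elim (ℕP.<-irrefl refl (ℕP.≤-trans (s≤s (ℕP.m≤m+n m′ k)) x≤m′))
      ... | no  _    = cong (potential X₂) (trans (cong (_∸ m′) (sym (ℕP.+-suc m′ k))) (ℕP.m+n∸m≡n m′ (suc k)))

    edgeValues-cycle₁ : Circulation (suc m′) X₁ → edgeValues wp (cycle₁ m′) ≡ X₁
    edgeValues-cycle₁ circ = begin
      edgeValues wp (cycle₁ m′)
        ≡⟨ map-++ (edgeValue wp) (consecutive 0 m′) _ ⟩
      edgeValues wp (consecutive 0 m′) ∷ʳ edgeValue wp (m′ , 0)
        ≡⟨ cong₂ _∷ʳ_ path (edgeValue-closing wp X₁ circ (coord-cycle₁ ℕP.≤-refl) (coord-cycle₁ z≤n)) ⟩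
      applyUpTo (nth 0ℚ X₁) m′ ∷ʳ nth 0ℚ X₁ m′
        ≡⟨ applyUpTo-∷ʳ (nth 0ℚ X₁) m′ ⟩
      applyUpTo (nth 0ℚ X₁) (suc m′)
        ≡⟨ applyUpTo-nth 0ℚ X₁ (proj₁ circ) ⟩
      X₁ ∎
      where
      open ≡-Reasoning
      path : edgeValues wp (consecutive 0 m′) ≡ applyUpTo (nth 0ℚ X₁) m′
      path = trans (map-applyUpTo _ (edgeValue wp) m′) (applyUpTo-cong m′ (λ k<m′ →
        edgeValue-potential wp X₁ _ (coord-cycle₁ (ℕP.<⇒≤ k<m′)) (coord-cycle₁ k<m′)))

    edgeValues-cycle₂ : Circulation (suc (suc l)) X₂ → edgeValues wp (cycle₂ m′ l) ≡ X₂
    edgeValues-cycle₂ circ = begin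
      edgeValues wp (cycle₂ m′ l)
        ≡⟨ cong (edgeValue wp (0 , suc m′) ∷_) (map-++ (edgeValue wp) (consecutive (suc m′) l) _) ⟩
      edgeValue wp (0 , suc m′) ∷ (edgeValues wp (consecutive (suc m′) l) ∷ʳ edgeValue wp (suc m′ ℕ.+ l , 0))
        ≡⟨ cong₂ _∷_ first
             (cong₂ _∷ʳ_ path (edgeValue-closing wp X₂ circ (coord-cycle₂ ℕP.≤-refl) (coord-cycle₁ z≤n))) ⟩
      nth 0ℚ X₂ 0 ∷ (applyUpTo (nth 0ℚ X₂ ∘ suc) l ∷ʳ nth 0ℚ X₂ (suc l))
        ≡⟨ cong (nth 0ℚ X₂ 0 ∷_) (applyUpTo-∷ʳ (nth 0ℚ X₂ ∘ suc) l) ⟩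
      applyUpTo (nth 0ℚ X₂) (suc (suc l))
        ≡⟨ applyUpTo-nth 0ℚ X₂ (proj₁ circ) ⟩
      X₂ ∎
      where
      open ≡-Reasoning
      first : edgeValue wp (0 , suc m′) ≡ nth 0ℚ X₂ 0
      first = edgeValue-potential wp X₂ 0 (coord-cycle₁ z≤n)
        (trans (cong (coord wp) (sym (ℕP.+-identityʳ (suc m′)))) (coord-cycle₂ z≤n))
      path : edgeValues wp (consecutive (suc m′) l) ≡ applyUpTo (nth 0ℚ X₂ ∘ suc) l
      path = trans (map-applyUpTo _ (edgeValue wp) l) (applyUpTo-cong l (λ {k} k<l →
        edgeValue-potential wp X₂ (suc k) (coord-cycle₂ (ℕP.<⇒≤ k<l))
          (trans (cong (coord wp) (sym (ℕP.+-suc (suc m′) k))) (coord-cycle₂ k<l))))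

    wedgePoint-edgeValues : Circulation (suc m′) X₁ → Circulation (suc (suc l)) X₂ →
      edgeValues wp (wedgeEdges (suc m′) (suc (suc l))) ≡ X₁ ++ X₂
    wedgePoint-edgeValues circ₁ circ₂ =
      trans (edgeValues-wedge wp m′ l) (cong₂ _++_ (edgeValues-cycle₁ circ₁) (edgeValues-cycle₂ circ₂))

module SignVectors where

  open import Data.List using (head)
  open import Data.List.Properties using (length-map; length-++; ∷-injectiveʳ)
  open import Data.List.Membership.Propositional using (_∈_)
  open import Data.List.Membership.Propositional.Properties using (∈-map⁺)
  open import Data.List.Relation.Binary.Disjoint.Propositional using (Disjoint)
  open import Data.List.Relation.Unary.All as All using (All; []; _∷_)
  import Data.List.Relation.Unary.All.Properties as All
  open import Data.List.Relation.Unary.AllPairs using ([]; _∷_)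
  open import Data.List.Relation.Unary.Any using (here)
  open import Data.List.Relation.Unary.Any.Properties using (++⁺ˡ; ++⁺ʳ)
  open import Data.List.Relation.Unary.Unique.Propositional using (Unique)
  import Data.List.Relation.Unary.Unique.Propositional.Properties as Unique
  open import Data.Maybe using (Maybe; just; nothing)
  open import Data.Nat using (_+_; _*_; _!)
  open import Data.Nat.Properties using (+-suc; suc-injective)
  open import Data.Nat.Tactic.RingSolver using (solve-∀)

  data Sign : Set where
    plus minus none : Sign

  pluses minuses nones : List Sign → ℕ
  pluses []           = 0
  pluses (plus ∷ c)   = suc (pluses c)
  pluses (_ ∷ c)      = pluses c
  minuses []          = 0
  minuses (minus ∷ c) = suc (minuses c)
  minuses (_ ∷ c)     = minuses c
  nones []            = 0
  nones (none ∷ c)    = suc (nones c)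
  nones (_ ∷ c)       = nones c

  mutual
    signVectors : ℕ → ℕ → ℕ → List (List Sign)
    signVectors p q z =
      startingWith plus p q z ++ startingWith minus p q z ++ startingWith none p q z ++ emptyIfZero p q z

    startingWith : Sign → ℕ → ℕ → ℕ → List (List Sign)
    startingWith plus  zero    q z = []
    startingWith plus  (suc p) q z = map (plus ∷_) (signVectors p q z)
    startingWith minus p zero    z = []
    startingWith minus p (suc q) z = map (minus ∷_) (signVectors p q z)
    startingWith none  p q zero    = []
    startingWith none  p q (suc z) = map (none ∷_) (signVectors p q z)

    emptyIfZero : ℕ → ℕ → ℕ → List (List Sign)
    emptyIfZero zero    zero    zero    = [] ∷ []
    emptyIfZero (suc p) q       z       = []
    emptyIfZero zero    (suc q) z       = []
    emptyIfZero zero    zero    (suc z) = []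

  HasCounts : ℕ → ℕ → ℕ → List Sign → Set
  HasCounts p q z c = pluses c ≡ p × minuses c ≡ q × nones c ≡ z

  private
    ∈-signVectors-counts : (c : List Sign) → c ∈ signVectors (pluses c) (minuses c) (nones c)
    ∈-signVectors-counts []          = here refl
    ∈-signVectors-counts (plus ∷ c)  = ++⁺ˡ (∈-map⁺ (plus ∷_) (∈-signVectors-counts c))
    ∈-signVectors-counts (minus ∷ c) = ++⁺ʳ (startingWith plus (pluses c) (suc (minuses c)) (nones c))
      (++⁺ˡ (∈-map⁺ (minus ∷_) (∈-signVectors-counts c)))
    ∈-signVectors-counts (none ∷ c)  = ++⁺ʳ (startingWith plus (pluses c) (minuses c) (suc (nones c)))
      (++⁺ʳ (startingWith minus (pluses c) (minuses c) (suc (nones c)))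
        (++⁺ˡ (∈-map⁺ (none ∷_) (∈-signVectors-counts c))))

  signVectors-complete : ∀ {p q z c} → HasCounts p q z c → c ∈ signVectors p q z
  signVectors-complete {c = c} (refl , refl , refl) = ∈-signVectors-counts c

  mutual
    signVectors-counts : ∀ p q z → All (HasCounts p q z) (signVectors p q z)
    signVectors-counts p q z = All.++⁺ (startingWith-counts plus p q z)
      (All.++⁺ (startingWith-counts minus p q z)
        (All.++⁺ (startingWith-counts none p q z) (emptyIfZero-counts p q z)))

    startingWith-counts : ∀ s p q z → All (HasCounts p q z) (startingWith s p q z)
    startingWith-counts plus  zero    q z = []
    startingWith-counts plus  (suc p) q z =
      All.map⁺ (All.map (λ (p≡ , q≡ , z≡) → cong suc p≡ , q≡ , z≡) (signVectors-counts p q z))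
    startingWith-counts minus p zero    z = []
    startingWith-counts minus p (suc q) z =
      All.map⁺ (All.map (λ (p≡ , q≡ , z≡) → p≡ , cong suc q≡ , z≡) (signVectors-counts p q z))
    startingWith-counts none  p q zero    = []
    startingWith-counts none  p q (suc z) =
      All.map⁺ (All.map (λ (p≡ , q≡ , z≡) → p≡ , q≡ , cong suc z≡) (signVectors-counts p q z))

    emptyIfZero-counts : ∀ p q z → All (HasCounts p q z) (emptyIfZero p q z)
    emptyIfZero-counts zero    zero    zero    = (refl , refl , refl) ∷ []
    emptyIfZero-counts (suc p) q       z       = []
    emptyIfZero-counts zero    (suc q) z       = []
    emptyIfZero-counts zero    zero    (suc z) = []

  signVectors-sound : ∀ {p q z c} → c ∈ signVectors p q z → HasCounts p q z c
  signVectors-sound {p} {q} {z} = All.lookup (signVectors-counts p q z)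

  private
    heads-startingWith : ∀ s p q z → All (λ c → head c ≡ just s) (startingWith s p q z)
    heads-startingWith plus  zero    q z = []
    heads-startingWith plus  (suc p) q z = All.map⁺ (All.tabulate (λ _ → refl))
    heads-startingWith minus p zero    z = []
    heads-startingWith minus p (suc q) z = All.map⁺ (All.tabulate (λ _ → refl))
    heads-startingWith none  p q zero    = []
    heads-startingWith none  p q (suc z) = All.map⁺ (All.tabulate (λ _ → refl))

    heads-emptyIfZero : ∀ p q z → All (λ c → head c ≡ nothing) (emptyIfZero p q z)
    heads-emptyIfZero zero    zero    zero    = refl ∷ []
    heads-emptyIfZero (suc p) q       z       = []
    heads-emptyIfZero zero    (suc q) z       = []
    heads-emptyIfZero zero    zero    (suc z) = []

    avoids : {h h′ : Maybe Sign} {cs : List (List Sign)} → ¬ h′ ≡ h →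
      All (λ c → head c ≡ h′) cs → All (λ c → ¬ head c ≡ h) cs
    avoids h′≢h = All.map (λ eq eq′ → h′≢h (trans (sym eq) eq′))

    Disjoint-heads : {h : Maybe Sign} {cs ds : List (List Sign)} →
      All (λ c → head c ≡ h) cs → All (λ c → ¬ head c ≡ h) ds → Disjoint cs ds
    Disjoint-heads hcs hds (c∈cs , c∈ds) = All.lookup hds c∈ds (All.lookup hcs c∈cs)

  -- The four blocks of `signVectors` are told apart by the head of the vector.
  mutual
    signVectors-unique : ∀ p q z → Unique (signVectors p q z)
    signVectors-unique p q z =
      Unique.++⁺ (startingWith-unique plus p q z)
        (Unique.++⁺ (startingWith-unique minus p q z)
          (Unique.++⁺ (startingWith-unique none p q z) (emptyIfZero-unique p q z)
            (Disjoint-heads (hd none) (avoids (λ ()) h∅)))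
          (Disjoint-heads (hd minus) (All.++⁺ (avoids (λ ()) (hd none)) (avoids (λ ()) h∅))))
        (Disjoint-heads (hd plus)
          (All.++⁺ (avoids (λ ()) (hd minus)) (All.++⁺ (avoids (λ ()) (hd none)) (avoids (λ ()) h∅))))
      where
      hd : ∀ s → All (λ c → head c ≡ just s) (startingWith s p q z)
      hd s = heads-startingWith s p q z
      h∅ = heads-emptyIfZero p q z

    startingWith-unique : ∀ s p q z → Unique (startingWith s p q z)
    startingWith-unique plus  zero    q z = []
    startingWith-unique plus  (suc p) q z = Unique.map⁺ (∷-injectiveʳ) (signVectors-unique p q z)
    startingWith-unique minus p zero    z = []
    startingWith-unique minus p (suc q) z = Unique.map⁺ (∷-injectiveʳ) (signVectors-unique p q z)
    startingWith-unique none  p q zero    = []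
    startingWith-unique none  p q (suc z) = Unique.map⁺ (∷-injectiveʳ) (signVectors-unique p q z)

    emptyIfZero-unique : ∀ p q z → Unique (emptyIfZero p q z)
    emptyIfZero-unique zero    zero    zero    = [] ∷ []
    emptyIfZero-unique (suc p) q       z       = []
    emptyIfZero-unique zero    (suc q) z       = []
    emptyIfZero-unique zero    zero    (suc z) = []

  weight : Sign → ℕ → ℕ → ℕ → ℕ
  weight plus  p q z = p
  weight minus p q z = q
  weight none  p q z = z

  private
    W : ℕ → ℕ → ℕ → ℕ
    W p q z = p ! * (q ! * z !)

  mutual
    length-signVectors : ∀ p q z → length (signVectors p q z) * (p ! * (q ! * z !)) ≡ (p + q + z) !
    length-signVectors zero    zero    zero    = refl
    length-signVectors (suc p) q       z       = length-signVectors-suc (suc p) q z refl refl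
    length-signVectors zero    (suc q) z       = length-signVectors-suc zero (suc q) z refl refl
    length-signVectors zero    zero    (suc z) = length-signVectors-suc zero zero (suc z) refl refl

    length-signVectors-suc : ∀ p q z {s} → p + q + z ≡ suc s → length (emptyIfZero p q z) ≡ 0 →
      length (signVectors p q z) * W p q z ≡ (p + q + z) !
    length-signVectors-suc p q z {s} p+q+z≡1+s no-empty = begin
      length (signVectors p q z) * W p q z
        ≡⟨ cong (_* W p q z) (trans (length-++ (ℓ plus)) (cong (length (ℓ plus) +_)
             (trans (length-++ (ℓ minus)) (cong (length (ℓ minus) +_) (length-++ (ℓ none)))))) ⟩
      (length (ℓ plus) + (length (ℓ minus) + (length (ℓ none) + length (emptyIfZero p q z)))) * W p q z
        ≡⟨ distrib (length (ℓ plus)) (length (ℓ minus)) (length (ℓ none)) _ (W p q z) ⟩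
      length (ℓ plus) * W p q z + (length (ℓ minus) * W p q z
        + (length (ℓ none) * W p q z + length (emptyIfZero p q z) * W p q z))
        ≡⟨ cong₂ _+_ (group plus) (cong₂ _+_ (group minus)
             (cong₂ _+_ (group none) (cong (_* W p q z) no-empty))) ⟩
      p * s ! + (q * s ! + (z * s ! + 0))
        ≡⟨ collect p q z (s !) ⟩
      (p + q + z) * s !
        ≡⟨ cong (λ k → k * s ! ) p+q+z≡1+s ⟩
      suc s !
        ≡⟨ cong _! p+q+z≡1+s ⟨
      (p + q + z) ! ∎
      where
      open ≡-Reasoning
      ℓ : Sign → List (List Sign)
      ℓ σ = startingWith σ p q z
      group : ∀ σ → length (ℓ σ) * W p q z ≡ weight σ p q z * s !
      group σ = length-startingWith σ p q z p+q+z≡1+s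
      distrib : ∀ a b c d w → (a + (b + (c + d))) * w ≡ a * w + (b * w + (c * w + d * w))
      distrib = solve-∀
      collect : ∀ p q z f → p * f + (q * f + (z * f + 0)) ≡ (p + q + z) * f
      collect = solve-∀

    length-startingWith : ∀ σ p q z {s} → p + q + z ≡ suc s →
      length (startingWith σ p q z) * W p q z ≡ weight σ p q z * s !
    length-startingWith plus  zero    q z _  = refl
    length-startingWith plus  (suc p) q z {s} eq = begin
      length (map (plus ∷_) (signVectors p q z)) * W (suc p) q z
        ≡⟨ cong (_* W (suc p) q z) (length-map (plus ∷_) (signVectors p q z)) ⟩
      length (signVectors p q z) * ((p ! + p * p !) * (q ! * z !))
        ≡⟨ shift (length (signVectors p q z)) p (p !) (q ! * z !) ⟩
      suc p * (length (signVectors p q z) * W p q z)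
        ≡⟨ cong (suc p *_) (trans (length-signVectors p q z) (cong _! (suc-injective eq))) ⟩
      suc p * s ! ∎
      where
      open ≡-Reasoning
      shift : ∀ l p f w → l * ((f + p * f) * w) ≡ suc p * (l * (f * w))
      shift = solve-∀
    length-startingWith minus p zero    z _  = refl
    length-startingWith minus p (suc q) z {s} eq = begin
      length (map (minus ∷_) (signVectors p q z)) * W p (suc q) z
        ≡⟨ cong (_* W p (suc q) z) (length-map (minus ∷_) (signVectors p q z)) ⟩
      length (signVectors p q z) * (p ! * ((q ! + q * q !) * z !))
        ≡⟨ shift (length (signVectors p q z)) q (q !) (p !) (z !) ⟩
      suc q * (length (signVectors p q z) * W p q z)
        ≡⟨ cong (suc q *_) (trans (length-signVectors p q z)
             (cong _! (suc-injective (trans (cong (_+ z) (sym (+-suc p q))) eq)))) ⟩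
      suc q * s ! ∎
      where
      open ≡-Reasoning
      shift : ∀ l q f u w → l * (u * ((f + q * f) * w)) ≡ suc q * (l * (u * (f * w)))
      shift = solve-∀
    length-startingWith none  p q zero    _  = refl
    length-startingWith none  p q (suc z) {s} eq = begin
      length (map (none ∷_) (signVectors p q z)) * W p q (suc z)
        ≡⟨ cong (_* W p q (suc z)) (length-map (none ∷_) (signVectors p q z)) ⟩
      length (signVectors p q z) * (p ! * (q ! * (z ! + z * z !)))
        ≡⟨ shift (length (signVectors p q z)) z (z !) (p !) (q !) ⟩
      suc z * (length (signVectors p q z) * W p q z)
        ≡⟨ cong (suc z *_) (trans (length-signVectors p q z)
             (cong _! (suc-injective (trans (sym (+-suc (p + q) z)) eq)))) ⟩
      suc z * s ! ∎
      where
      open ≡-Reasoning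
      shift : ∀ l z f u v → l * (u * (v * (f + z * f))) ≡ suc z * (l * (u * (v * f)))
      shift = solve-∀

module BalancedCount where

  open SignVectors

  open import Data.Nat using (_+_; _*_; _!; _<_; _≤_; NonZero; >-nonZero)
  open import Data.Nat.Properties
  open import Data.Nat.Tactic.RingSolver using (solve-∀)

  balancedCount : ℕ → ℕ
  balancedCount k = length (signVectors k k 1)

  balancedCount-factorial : ∀ k → balancedCount k * (k ! * (k ! * 1)) ≡ (k + k + 1) !
  balancedCount-factorial k = length-signVectors k k 1

  balancedCount-pos : ∀ k → 0 < balancedCount k
  balancedCount-pos k with balancedCount k | balancedCount-factorial k
  ... | suc _ | _   = s≤s z≤n
  ... | zero  | 0≡! with subst (1 ≤_) (sym 0≡!) (1≤n! (k + k + 1))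
  ...   | ()

  private
    g : ℕ → ℕ
    g = balancedCount

  balancedCount-suc : ∀ k → balancedCount (suc k) * suc k ≡ (4 * k + 6) * balancedCount k
  balancedCount-suc k =
    *-cancelʳ-≡ _ _ (suc k * (k ! * k !)) {{m*n≢0 (suc k) (k ! * k !) {{_}} {{k !* k !≢0}}}} (begin
    (g (suc k) * suc k) * (suc k * (K * K))     ≡⟨ regroup (g (suc k)) k K ⟩
    g (suc k) * (suc k ! * (suc k ! * 1))       ≡⟨ balancedCount-factorial (suc k) ⟩
    (suc k + suc k + 1) !                       ≡⟨ cong (λ t → suc (t + 1) !) (+-suc k k) ⟩
    suc (suc s) * (suc s * s !)
      ≡⟨ cong (λ t → suc (suc s) * (suc s * t)) (balancedCount-factorial k) ⟨
    suc (suc s) * (suc s * (g k * (K * (K * 1)))) ≡⟨ expand (g k) k K ⟩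
    ((4 * k + 6) * g k) * (suc k * (K * K))     ∎)
    where
    open ≡-Reasoning
    K = k !
    s = k + k + 1
    regroup : ∀ G k K → (G * suc k) * (suc k * (K * K)) ≡ G * ((suc k * K) * ((suc k * K) * 1))
    regroup = solve-∀
    expand : ∀ g k K → suc (suc (k + k + 1)) * (suc (k + k + 1) * (g * (K * (K * 1))))
                       ≡ ((4 * k + 6) * g) * (suc k * (K * K))
    expand = solve-∀

  private
    g-nonZero : ∀ x y → NonZero (g x * g y)
    g-nonZero x y = m*n≢0 (g x) (g y) {{>-nonZero (balancedCount-pos x)}} {{>-nonZero (balancedCount-pos y)}}

  balancedCount-logConcave : ∀ {x y} → x < y → g x * g (suc y) < g (suc x) * g y
  balancedCount-logConcave {x} {y} x<y with m≤n⇒∃[o]m+o≡n x<y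
  ... | e , refl = *-cancelʳ-< (suc x * suc y) _ _ (begin-strict
    g x * g (suc y) * (suc x * suc y)  ≡⟨ regroupˡ (g x) (g (suc y)) x y ⟩
    g x * (g (suc y) * suc y) * suc x  ≡⟨ cong (λ t → g x * t * suc x) (balancedCount-suc y) ⟩
    g x * ((4 * y + 6) * g y) * suc x  ≡⟨ regroupʳ (g x) (g y) x y ⟩
    G * ((4 * y + 6) * suc x)          <⟨ *-monoʳ-< G {{g-nonZero x y}} ratios ⟩
    G * ((4 * x + 6) * suc y)          ≡⟨ regroupʳ′ (g x) (g y) x y ⟩
    (4 * x + 6) * g x * g y * suc y    ≡⟨ cong (λ t → t * g y * suc y) (balancedCount-suc x) ⟨
    g (suc x) * suc x * g y * suc y    ≡⟨ regroupˡ′ (g (suc x)) (g y) x y ⟩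
    g (suc x) * g y * (suc x * suc y)  ∎)
    where
    open ≤-Reasoning
    G = g x * g y
    regroupˡ : ∀ a b x y → a * b * (suc x * suc y) ≡ a * (b * suc y) * suc x
    regroupˡ = solve-∀
    regroupʳ : ∀ a b x y → a * ((4 * y + 6) * b) * suc x ≡ (a * b) * ((4 * y + 6) * suc x)
    regroupʳ = solve-∀
    regroupʳ′ : ∀ a b x y → (a * b) * ((4 * x + 6) * suc y) ≡ (4 * x + 6) * a * b * suc y
    regroupʳ′ = solve-∀
    regroupˡ′ : ∀ a b x y → a * suc x * b * suc y ≡ a * b * (suc x * suc y)
    regroupˡ′ = solve-∀
    gap : ∀ x e → (4 * x + 6) * suc (suc x + e) ≡ (4 * (suc x + e) + 6) * suc x + (2 + 2 * e)
    gap = solve-∀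
    ratios : (4 * y + 6) * suc x < (4 * x + 6) * suc y
    ratios = subst ((4 * y + 6) * suc x <_) (sym (gap x e)) (m<m+n _ (s≤s z≤n))

  balancedCount-spread : ∀ {μ β} d → μ < β → g μ * g (β + suc d) < g (μ + suc d) * g β
  balancedCount-spread {μ} {β} zero    μ<β = subst₂ (λ u v → g μ * g u < g v * g β)
    (+-comm 1 β) (+-comm 1 μ) (balancedCount-logConcave μ<β)
  balancedCount-spread {μ} {β} (suc d) μ<β = *-cancelʳ-< K _ _ (begin-strict
    g μ * g (β + suc (suc d)) * K
      ≡⟨ cong (λ t → g μ * g t * K) (+-suc β (suc d)) ⟩
    g μ * g (suc (β + suc d)) * K
      ≡⟨ regroup (g μ) (g (β + suc d)) (g (μ + suc d)) (g (suc (β + suc d))) ⟩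
    (g μ * g (β + suc d)) * (g (μ + suc d) * g (suc (β + suc d)))
      <⟨ *-mono-< (balancedCount-spread d μ<β) (balancedCount-logConcave (+-monoˡ-< (suc d) μ<β)) ⟩
    (g (μ + suc d) * g β) * (g (suc (μ + suc d)) * g (β + suc d))
      ≡⟨ regroup′ (g (μ + suc d)) (g β) (g (suc (μ + suc d))) (g (β + suc d)) ⟩
    g (suc (μ + suc d)) * g β * K
      ≡⟨ cong (λ t → g t * g β * K) (+-suc μ (suc d)) ⟨
    g (μ + suc (suc d)) * g β * K ∎)
    where
    open ≤-Reasoning
    K = g (μ + suc d) * g (β + suc d)
    regroup : ∀ a b c e → a * e * (c * b) ≡ (a * b) * (c * e)
    regroup = solve-∀
    regroup′ : ∀ c b f e → (c * b) * (f * e) ≡ f * b * (c * e)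
    regroup′ = solve-∀

  balancedCount-*-< : ∀ {μ ν α β} → μ < α → α ≤ β → α + β ≡ μ + ν → g μ * g ν < g α * g β
  balancedCount-*-< {μ} {ν} {α} {β} μ<α α≤β α+β≡μ+ν with m≤n⇒∃[o]m+o≡n μ<α
  ... | d , refl = subst₂ (λ u v → g μ * g u < g v * g β) (sym ν≡β+1+d) (+-suc μ d)
                          (balancedCount-spread d (<-≤-trans μ<α α≤β))
    where
    shuffle : ∀ μ d β → suc μ + d + β ≡ μ + (β + suc d)
    shuffle = solve-∀
    ν≡β+1+d : ν ≡ β + suc d
    ν≡β+1+d = +-cancelˡ-≡ μ ν (β + suc d) (trans (sym α+β≡μ+ν) (shuffle μ d β))

module Cycles where

  open Lists using (nth)
  open EdgeValues
  open Circulations using (Circulation)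
  open SignVectors

  open import Algebra.Properties.Monoid.Mult ℚP.+-0-monoid using (×-homo-+) renaming (_×_ to _×ℚ_)
  open import Data.List.Properties using (length-map)
  open import Data.List.Membership.Propositional using (_∈_)
  open import Data.List.Relation.Binary.Pointwise using (Pointwise; []; _∷_)
  open import Data.List.Relation.Unary.All as All using (All; []; _∷_)
  import Data.List.Relation.Unary.All.Properties as All
  open import Data.Rational using (_+_; _*_; -_; _-_; _≤_; _<_)
  open import Data.Rational.Properties using (_≟_)
  open import Tactic.RingSolver using (solve-∀)

  value : Sign → ℚ
  value plus  = 1ℚ
  value minus = - 1ℚ
  value none  = 0ℚ

  sumℚ-value : (c : List Sign) → sumℚ (map value c) ≡ pluses c ×ℚ 1ℚ - minuses c ×ℚ 1ℚ
  sumℚ-value []          = refl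
  sumℚ-value (plus ∷ c)  = trans (cong (1ℚ +_) (sumℚ-value c)) (shift 1ℚ (pluses c ×ℚ 1ℚ) (minuses c ×ℚ 1ℚ))
    where
    shift : ∀ o x y → o + (x - y) ≡ (o + x) - y
    shift = solve-∀ ℚ-ring
  sumℚ-value (minus ∷ c) = trans (cong (- 1ℚ +_) (sumℚ-value c)) (shift 1ℚ (pluses c ×ℚ 1ℚ) (minuses c ×ℚ 1ℚ))
    where
    shift : ∀ o x y → - o + (x - y) ≡ x - (o + y)
    shift = solve-∀ ℚ-ring
  sumℚ-value (none ∷ c)  = trans (ℚP.+-identityˡ _) (sumℚ-value c)

  length-counts : (c : List Sign) → length c ≡ pluses c ℕ.+ minuses c ℕ.+ nones c
  length-counts []          = refl
  length-counts (plus ∷ c)  = cong suc (length-counts c)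
  length-counts (minus ∷ c) = trans (cong suc (length-counts c))
                                    (cong (ℕ._+ nones c) (sym (ℕP.+-suc (pluses c) (minuses c))))
  length-counts (none ∷ c)  = trans (cong suc (length-counts c))
                                    (sym (ℕP.+-suc (pluses c ℕ.+ minuses c) (nones c)))

  module Balanced (k : ℕ) {c : List Sign} (c∈ : c ∈ signVectors k k 1) where

    private
      counts : HasCounts k k 1 c
      counts = signVectors-sound {k} {k} {1} c∈

    length-balanced : length c ≡ suc (k ℕ.+ k)
    length-balanced = trans (length-counts c)
      (trans (cong₂ (λ p q → p ℕ.+ q ℕ.+ nones c) (proj₁ counts) (proj₁ (proj₂ counts)))
             (trans (cong (k ℕ.+ k ℕ.+_) (proj₂ (proj₂ counts))) (ℕP.+-comm (k ℕ.+ k) 1)))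

    sum-balanced : sumℚ (map value c) ≡ 0ℚ
    sum-balanced = trans (sumℚ-value c)
      (trans (cong₂ (λ p q → p ×ℚ 1ℚ - q ×ℚ 1ℚ) (proj₁ counts) (proj₁ (proj₂ counts)))
             (ℚP.+-inverseʳ (k ×ℚ 1ℚ)))

    nones-balanced : nones c ≡ 1
    nones-balanced = proj₂ (proj₂ counts)

    circulation-balanced : Circulation (suc (k ℕ.+ k)) (map value c)
    circulation-balanced = trans (length-map value c) length-balanced , sum-balanced

  occurrences : ℚ → List ℚ → ℕ
  occurrences b []      = 0
  occurrences b (x ∷ V) with x ≟ b
  ... | yes _ = suc (occurrences b V)
  ... | no  _ = occurrences b V

  module _ {b x : ℚ} (V : List ℚ) where

    occurrences-≡ : x ≡ b → occurrences b (x ∷ V) ≡ suc (occurrences b V)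
    occurrences-≡ x≡b with x ≟ b
    ... | yes _   = refl
    ... | no  x≢b = ⊥-elim (x≢b x≡b)

    occurrences-≢ : ¬ x ≡ b → occurrences b (x ∷ V) ≡ occurrences b V
    occurrences-≢ x≢b with x ≟ b
    ... | yes x≡b = ⊥-elim (x≢b x≡b)
    ... | no  _   = refl

  occurrences-neg : (b : ℚ) (V : List ℚ) → occurrences (- b) (map -_ V) ≡ occurrences b V
  occurrences-neg b []      = refl
  occurrences-neg b (x ∷ V) with x ≟ b
  ... | yes x≡b = trans (occurrences-≡ (map -_ V) (cong -_ x≡b)) (cong suc (occurrences-neg b V))
  ... | no  x≢b = trans (occurrences-≢ (map -_ V) (x≢b ∘ ℚP.neg-injective)) (occurrences-neg b V)

  occurrences-± : {b : ℚ} → ¬ b ≡ - b → (V : List ℚ) →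
    occurrences b V ℕ.+ occurrences (- b) V ℕ.≤ length V
  occurrences-± b≢-b []      = z≤n
  occurrences-± {b} b≢-b (x ∷ V) with x ≟ b | x ≟ - b
  ... | yes x≡b | yes x≡-b = ⊥-elim (b≢-b (trans (sym x≡b) x≡-b))
  ... | yes _   | no  _    = s≤s (occurrences-± b≢-b V)
  ... | no  _   | yes _    = subst (ℕ._≤ suc (length V)) (sym (ℕP.+-suc (occurrences b V) _))
                                   (s≤s (occurrences-± b≢-b V))
  ... | no  _   | no  _    = ℕP.m≤n⇒m≤1+n (occurrences-± b≢-b V)

  Compatible : ℚ → ℚ → Sign → Set
  Compatible b x s = (x ≡ b → s ≡ plus) × (x ≡ - b → s ≡ minus)

  module _ {b : ℚ} (b≢-b : ¬ b ≡ - b) where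

    CompatibleSigns : ℕ → ℕ → ℕ → List ℚ → Set
    CompatibleSigns p q z V = Σ (List Sign) λ c → HasCounts p q z c × Pointwise (Compatible b) V c

    private
      ≡b⇒≢-b : {x : ℚ} → x ≡ b → ¬ x ≡ - b
      ≡b⇒≢-b x≡b x≡-b = b≢-b (trans (sym x≡b) x≡-b)

      forcedPlus : {x : ℚ} → x ≡ b → Compatible b x plus
      forcedPlus x≡b = (λ _ → refl) , (λ x≡-b → ⊥-elim (≡b⇒≢-b x≡b x≡-b))

      forcedMinus : {x : ℚ} → ¬ x ≡ b → Compatible b x minus
      forcedMinus x≢b = (λ x≡b → ⊥-elim (x≢b x≡b)) , (λ _ → refl)

      unforced : {x : ℚ} → ¬ x ≡ b → ¬ x ≡ - b → (s : Sign) → Compatible b x s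
      unforced x≢b x≢-b s = (λ x≡b → ⊥-elim (x≢b x≡b)) , (λ x≡-b → ⊥-elim (x≢-b x≡-b))

    -- Greedily: forced entries take their sign, and a free entry takes `none` while one is still
    -- owed, otherwise `plus` or `minus`, whichever still has room.
    mutual
      fill : ∀ V p q z → occurrences b V ℕ.≤ p → occurrences (- b) V ℕ.≤ q →
        p ℕ.+ q ℕ.+ z ≡ length V → CompatibleSigns p q z V
      fill [] zero zero zero _ _ _ = [] , (refl , refl , refl) , []
      fill (x ∷ V) p q z occ⁺ occ⁻ len with x ≟ b
      fill (x ∷ V) zero    q z ()   occ⁻ len | yes x≡b
      fill (x ∷ V) (suc p) q z occ⁺ occ⁻ len | yes x≡b
        with fill V p q z (ℕP.≤-pred occ⁺) (subst (ℕ._≤ q) (occurrences-≢ V (≡b⇒≢-b x≡b)) occ⁻)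
                  (ℕP.suc-injective len)
      ... | c , (p≡ , q≡ , z≡) , compat = plus ∷ c , (cong suc p≡ , q≡ , z≡) , forcedPlus x≡b ∷ compat
      fill (x ∷ V) p q z occ⁺ occ⁻ len | no x≢b with x ≟ - b
      fill (x ∷ V) p zero    z occ⁺ ()   len | no x≢b | yes x≡-b
      fill (x ∷ V) p (suc q) z occ⁺ occ⁻ len | no x≢b | yes x≡-b
        with fill V p q z occ⁺ (ℕP.≤-pred occ⁻)
               (ℕP.suc-injective (trans (cong (ℕ._+ z) (sym (ℕP.+-suc p q))) len))
      ... | c , (p≡ , q≡ , z≡) , compat = minus ∷ c , (p≡ , cong suc q≡ , z≡) , forcedMinus x≢b ∷ compat
      fill (x ∷ V) p q z occ⁺ occ⁻ len | no x≢b | no x≢-b =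
        fillUnforced (unforced x≢b x≢-b) V p q z occ⁺ occ⁻ len

      fillUnforced : {x : ℚ} → (∀ s → Compatible b x s) → ∀ V p q z →
        occurrences b V ℕ.≤ p → occurrences (- b) V ℕ.≤ q →
        p ℕ.+ q ℕ.+ z ≡ suc (length V) → CompatibleSigns p q z (x ∷ V)
      fillUnforced free V p q (suc z) occ⁺ occ⁻ len
        with fill V p q z occ⁺ occ⁻ (ℕP.suc-injective (trans (sym (ℕP.+-suc (p ℕ.+ q) z)) len))
      ... | c , (p≡ , q≡ , z≡) , compat = none ∷ c , (p≡ , q≡ , cong suc z≡) , free none ∷ compat
      fillUnforced free V p q zero occ⁺ occ⁻ len with occurrences b V ℕ.<? p
      fillUnforced free V (suc p) q zero occ⁺ occ⁻ len | yes occ⁺<p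
        with fill V p q zero (ℕP.≤-pred occ⁺<p) occ⁻ (ℕP.suc-injective len)
      ... | c , (p≡ , q≡ , z≡) , compat = plus ∷ c , (cong suc p≡ , q≡ , z≡) , free plus ∷ compat
      fillUnforced free V p q zero occ⁺ occ⁻ len | no occ⁺≮p with occurrences (- b) V ℕ.<? q
      fillUnforced free V p (suc q) zero occ⁺ occ⁻ len | no _ | yes occ⁻<q
        with fill V p q zero occ⁺ (ℕP.≤-pred occ⁻<q)
               (ℕP.suc-injective (trans (cong (ℕ._+ 0) (sym (ℕP.+-suc p q))) len))
      ... | c , (p≡ , q≡ , z≡) , compat = minus ∷ c , (p≡ , cong suc q≡ , z≡) , free minus ∷ compat
      fillUnforced free V p q zero occ⁺ occ⁻ len | no occ⁺≮p | no occ⁻≮q =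
        ⊥-elim (ℕP.<-irrefl refl (ℕP.<-≤-trans too-many (occurrences-± b≢-b V)))
        where
        too-many : length V ℕ.< occurrences b V ℕ.+ occurrences (- b) V
        too-many = subst (ℕ._≤ occurrences b V ℕ.+ occurrences (- b) V)
          (trans (sym (ℕP.+-identityʳ (p ℕ.+ q))) len) (ℕP.+-mono-≤ (ℕP.≮⇒≥ occ⁺≮p) (ℕP.≮⇒≥ occ⁻≮q))

  ×ℚ-mono : {b : ℚ} → 0ℚ ≤ b → {m n : ℕ} → m ℕ.≤ n → m ×ℚ b ≤ n ×ℚ b
  ×ℚ-mono {b} b≥0 {n = n} z≤n = nonneg n
    where
    nonneg : ∀ n → 0ℚ ≤ n ×ℚ b
    nonneg zero    = ℚP.≤-refl
    nonneg (suc n) = ℚP.+-mono-≤ b≥0 (nonneg n)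
  ×ℚ-mono {b} b≥0 (s≤s m≤n) = ℚP.+-monoʳ-≤ b (×ℚ-mono b≥0 m≤n)

  -- Each entry is at most b, and each entry equal to −b falls short of b by 2b.
  sumℚ-occurrences-neg : (b : ℚ) (V : List ℚ) → All (_≤ b) V →
    sumℚ V + (occurrences (- b) V ×ℚ b + occurrences (- b) V ×ℚ b) ≤ length V ×ℚ b
  sumℚ-occurrences-neg b []      []           = ℚP.≤-refl
  sumℚ-occurrences-neg b (x ∷ V) (x≤b ∷ V≤b) with x ≟ - b
  ... | yes x≡-b = subst (_≤ b + length V ×ℚ b) (sym (trans (cong (λ y → (y + S) + ((b + O) + (b + O))) x≡-b)
                                                            (shift b S O)))
                         (ℚP.+-monoʳ-≤ b (sumℚ-occurrences-neg b V V≤b))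
    where
    S = sumℚ V
    O = occurrences (- b) V ×ℚ b
    shift : ∀ b S O → (- b + S) + ((b + O) + (b + O)) ≡ b + (S + (O + O))
    shift = solve-∀ ℚ-ring
  ... | no  _    = subst (_≤ b + length V ×ℚ b) (sym (ℚP.+-assoc x (sumℚ V) _))
                         (ℚP.+-mono-≤ x≤b (sumℚ-occurrences-neg b V V≤b))

  occurrences-neg-≤ : {b : ℚ} → 0ℚ < b → (V : List ℚ) {k : ℕ} → Circulation (suc (k ℕ.+ k)) V →
    All (_≤ b) V → occurrences (- b) V ℕ.≤ k
  occurrences-neg-≤ {b} b>0 V {k} (len , ΣV≡0) V≤b with occurrences (- b) V ℕ.≤? k
  ... | yes o≤k = o≤k
  ... | no  o≰k = ⊥-elim (ℚP.<-irrefl refl (ℚP.<-≤-trans M<b+M (ℚP.≤-trans b+M≤2O 2O≤M)))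
    where
    O = occurrences (- b) V ×ℚ b
    M = suc (k ℕ.+ k) ×ℚ b
    M<b+M : M < b + M
    M<b+M = subst (_< b + M) (ℚP.+-identityˡ M) (ℚP.+-monoˡ-< M b>0)
    b+M≤2O : b + M ≤ O + O
    b+M≤2O = subst (_≤ O + O)
      (trans (sym (×-homo-+ b (suc k) (suc k))) (cong (λ r → suc r ×ℚ b) (ℕP.+-suc k k)))
      (ℚP.+-mono-≤ (×ℚ-mono (ℚP.<⇒≤ b>0) (ℕP.≰⇒> o≰k)) (×ℚ-mono (ℚP.<⇒≤ b>0) (ℕP.≰⇒> o≰k)))
    2O≤M : O + O ≤ M
    2O≤M = subst (_≤ M) (ℚP.+-identityˡ (O + O))
      (subst₂ (λ S n → S + (O + O) ≤ n ×ℚ b) ΣV≡0 len (sumℚ-occurrences-neg b V V≤b))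

  occurrences-≤ : {b : ℚ} → 0ℚ < b → (V : List ℚ) {k : ℕ} → Circulation (suc (k ℕ.+ k)) V →
    All (λ x → - x ≤ b) V → occurrences b V ℕ.≤ k
  occurrences-≤ {b} b>0 V (len , ΣV≡0) V≥-b = subst (ℕ._≤ _) (occurrences-neg b V)
    (occurrences-neg-≤ b>0 (map -_ V) (trans (length-map -_ V) len , trans (sumℚ-neg V) (cong -_ ΣV≡0))
                       (All.map⁺ V≥-b))

  compatibleSigns : {b : ℚ} → 0ℚ < b → (V : List ℚ) {k : ℕ} → Circulation (suc (k ℕ.+ k)) V →
    All (_≤ b) V → All (λ x → - x ≤ b) V →
    Σ (List Sign) λ c → c ∈ signVectors k k 1 × Pointwise (Compatible b) V c
  compatibleSigns {b} b>0 V {k} circ V≤b V≥-b =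
    let (c , counts , compat) = fill b≢-b V k k 1 (occurrences-≤ b>0 V circ V≥-b)
                                    (occurrences-neg-≤ b>0 V circ V≤b)
                                    (trans (ℕP.+-comm (k ℕ.+ k) 1) (sym (proj₁ circ)))
    in c , signVectors-complete counts , compat
    where
    b≢-b : ¬ b ≡ - b
    b≢-b b≡-b = ℚP.<-asym b>0 (subst (_< 0ℚ) (sym b≡-b) (ℚP.neg-antimono-< b>0))

  Proportional : ℚ → ℚ → Sign → Set
  Proportional b v s = v ≡ value s * b

  ProportionalOffNone : ℚ → ℚ → Sign → Set
  ProportionalOffNone b v s = ¬ s ≡ none → Proportional b v s

  module _ {b : ℚ} where

    sumℚ-proportional : (V : List ℚ) (c : List Sign) → Pointwise (Proportional b) V c →
      sumℚ V ≡ sumℚ (map value c) * b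
    sumℚ-proportional []      []      []          = sym (ℚP.*-zeroˡ b)
    sumℚ-proportional (v ∷ V) (s ∷ c) (v≡ ∷ V≡) =
      trans (cong₂ _+_ v≡ (sumℚ-proportional V c V≡)) (sym (ℚP.*-distribʳ-+ b (value s) _))

    proportional-noNone : (V : List ℚ) (c : List Sign) → Pointwise (ProportionalOffNone b) V c →
      nones c ≡ 0 → Pointwise (Proportional b) V c
    proportional-noNone []      []          []       _  = []
    proportional-noNone (v ∷ V) (plus ∷ c)  (r ∷ rs) n≡0 = r (λ ()) ∷ proportional-noNone V c rs n≡0
    proportional-noNone (v ∷ V) (minus ∷ c) (r ∷ rs) n≡0 = r (λ ()) ∷ proportional-noNone V c rs n≡0

    private
      sumℚ-tail : (s : Sign) (c : List Sign) {v S : ℚ} → v ≡ value s * b →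
        v + S ≡ sumℚ (map value (s ∷ c)) * b → S ≡ sumℚ (map value c) * b
      sumℚ-tail s c {S = S} refl eq = begin
        S                               ≡⟨ cancel (x * b) S ⟩
        (x * b + S) - x * b             ≡⟨ cong (_- x * b) eq ⟩
        (x + C) * b - x * b             ≡⟨ expand x C b ⟩
        C * b                           ∎
        where
        open ≡-Reasoning
        x = value s
        C = sumℚ (map value c)
        cancel : ∀ y S → S ≡ (y + S) - y
        cancel = solve-∀ ℚ-ring
        expand : ∀ x C b → (x + C) * b - x * b ≡ C * b
        expand = solve-∀ ℚ-ring

    -- The entry at the position of `none` is pinned down by the sums.
    proportional-rigid : (V : List ℚ) (c : List Sign) → Pointwise (ProportionalOffNone b) V c →
      nones c ≡ 1 → sumℚ V ≡ sumℚ (map value c) * b → Pointwise (Proportional b) V c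
    proportional-rigid (v ∷ V) (plus ∷ c)  (r ∷ rs) n≡1 sum =
      r (λ ()) ∷ proportional-rigid V c rs n≡1 (sumℚ-tail plus c (r (λ ())) sum)
    proportional-rigid (v ∷ V) (minus ∷ c) (r ∷ rs) n≡1 sum =
      r (λ ()) ∷ proportional-rigid V c rs n≡1 (sumℚ-tail minus c (r (λ ())) sum)
    proportional-rigid (v ∷ V) (none ∷ c)  (_ ∷ rs) n≡1 sum = v≡0 ∷ rest
      where
      rest = proportional-noNone V c rs (ℕP.suc-injective n≡1)
      C = sumℚ (map value c)
      v≡0 : v ≡ 0ℚ * b
      v≡0 = begin
        v                             ≡⟨ cancel v (sumℚ V) ⟩
        (v + sumℚ V) - sumℚ V         ≡⟨ cong₂ _-_ sum (sumℚ-proportional V c rest) ⟩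
        (0ℚ + C) * b - C * b          ≡⟨ vanish C b ⟩
        0ℚ * b                        ∎
        where
        open ≡-Reasoning
        cancel : ∀ v S → v ≡ (v + S) - S
        cancel = solve-∀ ℚ-ring
        vanish : ∀ C b → (0ℚ + C) * b - C * b ≡ 0ℚ * b
        vanish = solve-∀ ℚ-ring

  proportional-balanced : {b : ℚ} (k : ℕ) {V : List ℚ} {c : List Sign} → sumℚ V ≡ 0ℚ → c ∈ signVectors k k 1 →
    Pointwise (ProportionalOffNone b) V c → Pointwise (Proportional b) V c
  proportional-balanced {b} k {V} {c} ΣV≡0 c∈ offNone = proportional-rigid V c offNone (nones-balanced)
    (trans ΣV≡0 (sym (trans (cong (_* b) sum-balanced) (ℚP.*-zeroˡ b))))
    where open Balanced k c∈

module SignFaces where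

  open Lists
  open EdgeValues
  open LevelSets
  open SignVectors using (Sign; plus; minus; none)
  open Cycles using (value; Compatible; Proportional; ProportionalOffNone)

  open import Algebra.Properties.Group ℚP.+-0-group using () renaming (⁻¹-involutive to neg-involutive)
  open import Data.Fin.Subset using (Subset; _∈_; _⊆_; ⊤)
  open import Data.Fin.Subset.Properties using (∈⊤)
  open import Data.List.Properties using (length-map)
  open import Data.List.Relation.Binary.Pointwise using (Pointwise; Pointwise-≡⇒≡)
  open import Data.List.Relation.Unary.All using (All)
  open import Data.Rational using (_*_; -_; _≤_)
  open import Data.Rational.Properties using (_≟_; _≤?_)
  open import Data.Vec using (tabulate)
  import Data.Vec as Vec
  open import Data.Vec.Properties using (lookup∘tabulate; tabulate-cong)
  open import Relation.Nullary.Decidable using (from-yes)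
  open import Tactic.RingSolver using (solve-∀)

  selects : Bool → Sign → Bool
  selects true  plus  = true
  selects true  minus = false
  selects true  none  = false
  selects false plus  = false
  selects false minus = true
  selects false none  = false

  signSelection : {n : ℕ} (E : List (ℕ × ℕ)) → List Sign → Fin (length (sepPoints n E)) → Bool
  signSelection {n} E c p = selects (edgeSign {n} E p) (nth none c (edgeIndex {n} E p))

  signFace : {n : ℕ} (E : List (ℕ × ℕ)) → List Sign → Subset (length (sepPoints n E))
  signFace {n} E c = tabulate (signSelection {n} E c)

  module _ {n : ℕ} (E : List (ℕ × ℕ)) (c : List Sign) {t : ℕ} (σ : Bool) (t<E : t ℕ.< length E) where

    private
      p : Fin (length (sepPoints n E))
      p = pointOf {n} E t σ t<E

    signSelection-pointOf : signSelection {n} E c p ≡ selects σ (nth none c t)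
    signSelection-pointOf =
      cong₂ (λ σ′ t′ → selects σ′ (nth none c t′)) (edgeSign-pointOf E t σ t<E) (edgeIndex-pointOf E t σ t<E)

    lookup-signFace : Vec.lookup (signFace {n} E c) p ≡ selects σ (nth none c t)
    lookup-signFace = trans (lookup∘tabulate (signSelection {n} E c) p) signSelection-pointOf

    pointOf-∈-signFace⁻ : p ∈ signFace {n} E c → selects σ (nth none c t) ≡ true
    pointOf-∈-signFace⁻ p∈ = trans (sym signSelection-pointOf) (∈-tabulate⁻ (signSelection {n} E c) p∈)

    pointOf-∈-signFace⁺ : selects σ (nth none c t) ≡ true → p ∈ signFace {n} E c
    pointOf-∈-signFace⁺ sel = ∈-tabulate⁺ (signSelection {n} E c) (trans signSelection-pointOf sel)

  signed-value≤1 : (σ : Bool) (s : Sign) → signed σ (value s) ≤ 1ℚ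
  signed-value≤1 true  plus  = from-yes (signed true (value plus) ≤? 1ℚ)
  signed-value≤1 true  minus = from-yes (signed true (value minus) ≤? 1ℚ)
  signed-value≤1 true  none  = from-yes (signed true (value none) ≤? 1ℚ)
  signed-value≤1 false plus  = from-yes (signed false (value plus) ≤? 1ℚ)
  signed-value≤1 false minus = from-yes (signed false (value minus) ≤? 1ℚ)
  signed-value≤1 false none  = from-yes (signed false (value none) ≤? 1ℚ)

  does-signed-value : (σ : Bool) (s : Sign) → does (signed σ (value s) ≟ 1ℚ) ≡ selects σ s
  does-signed-value true  plus  = refl
  does-signed-value true  minus = refl
  does-signed-value true  none  = refl
  does-signed-value false plus  = refl
  does-signed-value false minus = refl
  does-signed-value false none  = refl

  selects-injective : {s s′ : Sign} → selects true s ≡ selects true s′ → selects false s ≡ selects false s′ → s ≡ s′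
  selects-injective {plus}  {plus}  _ _ = refl
  selects-injective {minus} {minus} _ _ = refl
  selects-injective {none}  {none}  _ _ = refl
  selects-injective {plus}  {minus} () _
  selects-injective {plus}  {none}  () _
  selects-injective {minus} {plus}  () _
  selects-injective {minus} {none}  _ ()
  selects-injective {none}  {plus}  () _
  selects-injective {none}  {minus} _ ()

  selects-both : (s : Sign) → selects true s ≡ true → selects false s ≡ true → ⊥
  selects-both plus  _  ()
  selects-both minus () _
  selects-both none  () _

  selecting : (s : Sign) → ¬ s ≡ none → Σ Bool λ σ → selects σ s ≡ true
  selecting plus  _    = true , refl
  selecting minus _    = false , refl
  selecting none  s≢0 = ⊥-elim (s≢0 refl)

  selects-signed : {σ : Bool} {s : Sign} {v b : ℚ} → selects σ s ≡ true → signed σ v ≡ b → v ≡ value s * b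
  selects-signed {true}  {plus}  {b = b} _ refl = sym (ℚP.*-identityˡ b)
  selects-signed {false} {minus} {v}     _ refl = sym (flip v)
    where
    flip : ∀ v → (- 1ℚ) * (- v) ≡ v
    flip = solve-∀ ℚ-ring

  compatible-selects : {b x : ℚ} {s : Sign} (σ : Bool) → Compatible b x s → signed σ x ≡ b → selects σ s ≡ true
  compatible-selects true              (forced⁺ , _) x≡b  = cong (selects true) (forced⁺ x≡b)
  compatible-selects {x = x} false (_ , forced⁻) -x≡b =
    cong (selects false) (forced⁻ (trans (sym (neg-involutive x)) (cong -_ -x≡b)))

  signed-* : (σ : Bool) (x b : ℚ) → signed σ (x * b) ≡ signed σ x * b
  signed-* true  x b = refl
  signed-* false x b = ℚP.neg-distribˡ-* x b

  module _ {n : ℕ} (E : List (ℕ × ℕ)) where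

    private
      S : List (Point n)
      S = sepPoints n E

    length-edgeValues : (a : Point n) → length (edgeValues a E) ≡ length E
    length-edgeValues a = length-map (edgeValue a) E

    dot-value : {a : Point n} {c : List Sign} → edgeValues a E ≡ map value c → ∀ p →
      dot a (lookup S p) ≡ signed (edgeSign E p) (value (nth none c (edgeIndex E p)))
    dot-value {a} {c} a↦c p = trans (dot-sepPoints a E p)
      (cong (signed (edgeSign E p)) (trans (cong (λ V → nth 0ℚ V (edgeIndex E p)) a↦c)
                                           (nth-map value c (edgeIndex E p))))

    levelSet-signFace : {a : Point n} {c : List Sign} → edgeValues a E ≡ map value c →
      levelSet S a 1ℚ ≡ signFace E c
    levelSet-signFace {a} {c} a↦c = tabulate-cong λ p →
      trans (cong (λ x → does (x ≟ 1ℚ)) (dot-value a↦c p))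
            (does-signed-value (edgeSign E p) (nth none c (edgeIndex E p)))

    signFace-isFace : {a : Point n} {c : List Sign} → edgeValues a E ≡ map value c → IsFace S (signFace E c)
    signFace-isFace {a} {c} a↦c = subst (IsFace S) (levelSet-signFace a↦c)
      (levelSet-isFace S a 1ℚ (λ p → subst (_≤ 1ℚ) (sym (dot-value a↦c p))
        (signed-value≤1 (edgeSign E p) (nth none c (edgeIndex E p)))))

    signFace-≢⊤ : (c : List Sign) → 0 ℕ.< length E → ¬ signFace {n} E c ≡ ⊤
    signFace-≢⊤ c 0<E ≡⊤ = selects-both (nth none c 0) (in-⊤ true) (in-⊤ false)
      where
      in-⊤ : (σ : Bool) → selects σ (nth none c 0) ≡ true
      in-⊤ σ = pointOf-∈-signFace⁻ E c σ 0<E (subst (pointOf {n} E 0 σ 0<E ∈_) (sym ≡⊤) ∈⊤)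

    signFace-injective : {c c′ : List Sign} → length c ≡ length E → length c′ ≡ length E →
      signFace {n} E c ≡ signFace E c′ → c ≡ c′
    signFace-injective {c} {c′} |c| |c′| same = Pointwise-≡⇒≡ (Pointwise-from-nth (trans |c| (sym |c′|))
      λ {t} t<c → let t<E = subst (t ℕ.<_) |c| t<c
                      agree = λ σ → trans (sym (lookup-signFace E c σ t<E))
                                          (trans (cong (λ F → Vec.lookup F (pointOf E t σ t<E)) same)
                                                 (lookup-signFace E c′ σ t<E))
                  in selects-injective (agree true) (agree false))

    edgeValues-bounded : {a : Point n} {b : ℚ} → (∀ p → dot a (lookup S p) ≤ b) →
      All (_≤ b) (edgeValues a E) × All (λ x → - x ≤ b) (edgeValues a E)
    edgeValues-bounded {a} {b} bounded = All-from-nth (edgeValues a E) (bound true)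
                                       , All-from-nth (edgeValues a E) (bound false)
      where
      bound : (σ : Bool) {t : ℕ} → t ℕ.< length (edgeValues a E) → signed σ (nth 0ℚ (edgeValues a E) t) ≤ b
      bound σ {t} t<V = subst (_≤ b) (dot-pointOf a E t σ t<E) (bounded (pointOf E t σ t<E))
        where t<E = subst (t ℕ.<_) (length-edgeValues a) t<V

    levelSet⊆signFace : {a : Point n} {b : ℚ} {c : List Sign} → Pointwise (Compatible b) (edgeValues a E) c →
      levelSet S a b ⊆ signFace E c
    levelSet⊆signFace {a} {b} {c} compat {p} p∈ = ∈-tabulate⁺ (signSelection E c)
      (compatible-selects (edgeSign E p) (Pointwise-nth compat t<V)
        (trans (sym (dot-sepPoints a E p)) (∈-levelSet⁻ S a b p∈)))
      where t<V = subst (edgeIndex E p ℕ.<_) (sym (length-edgeValues a)) (edgeIndex-< E p)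

    signFace⊆⇒offNone : {a′ : Point n} {b′ : ℚ} {c : List Sign} → length c ≡ length E →
      signFace E c ⊆ levelSet S a′ b′ → Pointwise (ProportionalOffNone b′) (edgeValues a′ E) c
    signFace⊆⇒offNone {a′} {b′} {c} |c| F⊆H = Pointwise-from-nth (trans (length-edgeValues a′) (sym |c|))
      λ {t} t<V s≢0 → let t<E = subst (t ℕ.<_) (length-edgeValues a′) t<V
                          (σ , sel) = selecting (nth none c t) s≢0
                      in selects-signed sel (trans (sym (dot-pointOf a′ E t σ t<E))
                           (∈-levelSet⁻ S a′ b′ (F⊆H (pointOf-∈-signFace⁺ E c σ t<E sel))))

    dot-proportional : {a a′ : Point n} {b′ : ℚ} {c : List Sign} → edgeValues a E ≡ map value c →
      Pointwise (Proportional b′) (edgeValues a′ E) c → ∀ p → dot a′ (lookup S p) ≡ dot a (lookup S p) * b′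
    dot-proportional {a} {a′} {b′} {c} a↦c prop p = begin
      dot a′ (lookup S p)                                  ≡⟨ dot-sepPoints a′ E p ⟩
      signed σ (nth 0ℚ (edgeValues a′ E) t)                ≡⟨ cong (signed σ) (Pointwise-nth prop t<V) ⟩
      signed σ (value (nth none c t) * b′)                 ≡⟨ signed-* σ _ b′ ⟩
      signed σ (value (nth none c t)) * b′                 ≡⟨ cong (_* b′) (dot-value a↦c p) ⟨
      dot a (lookup S p) * b′                              ∎
      where
      open ≡-Reasoning
      σ = edgeSign E p
      t = edgeIndex E p
      t<V = subst (t ℕ.<_) (sym (length-edgeValues a′)) (edgeIndex-< E p)

    length-realized : {a : Point n} {c : List Sign} → edgeValues a E ≡ map value c → length c ≡ length E
    length-realized {a} {c} a↦c =
      trans (sym (length-map value c)) (trans (cong length (sym a↦c)) (length-edgeValues a))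

    -- A non-positive bound forces every edge value, hence every dot product, to vanish.
    levelSet-nonpositive : {a : Point n} {b : ℚ} → (∀ p → dot a (lookup S p) ≤ b) → b ≤ 0ℚ →
      levelSet S a b ≡ ⊤
    levelSet-nonpositive {a} {b} bounded b≤0 = levelSet≡⊤ S a b λ p →
      let σ = edgeSign E p
          t = edgeIndex E p
          x = nth 0ℚ (edgeValues a E) t
          bound : (σ′ : Bool) → signed σ′ x ≤ b
          bound σ′ = subst (_≤ b) (dot-pointOf a E t σ′ (edgeIndex-< E p))
                                  (bounded (pointOf E t σ′ (edgeIndex-< E p)))
          x≡0 : x ≡ 0ℚ
          x≡0 = ℚP.≤-antisym (ℚP.≤-trans (bound true) b≤0)
                  (subst (0ℚ ≤_) (neg-involutive x) (ℚP.neg-antimono-≤ (ℚP.≤-trans (bound false) b≤0)))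
          b≡0 : b ≡ 0ℚ
          b≡0 = ℚP.≤-antisym b≤0 (subst (_≤ b) (cong -_ x≡0) (bound false))
      in trans (dot-sepPoints a E p) (trans (cong (signed σ) x≡0) (trans (signed-0 σ) (sym b≡0)))
      where
      signed-0 : ∀ σ → signed σ 0ℚ ≡ 0ℚ
      signed-0 true  = refl
      signed-0 false = refl

module WedgeFacets (μ ν : ℕ) where

  open Lists
  open EdgeValues
  open LevelSets
  open Circulations
  open SignVectors
  open BalancedCount
  open Cycles
  open SignFaces

  open import Data.Fin.Properties using (injective⇒≤)
  open import Data.Fin.Subset using (Subset; _∈_; _⊆_; ⊤)
  open import Data.List using (cartesianProduct)
  open import Data.List.Properties using (length-++; map-++)
  open import Data.List.Membership.Propositional using () renaming (_∈_ to _∈ₗ_)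
  open import Data.List.Membership.Propositional.Properties
    using (∈-cartesianProduct⁺; ∈-cartesianProduct⁻; ∈-lookup)
  open import Data.List.Relation.Binary.Pointwise using (Pointwise; ++⁺; Pointwise-≡⇒≡)
  import Data.List.Relation.Binary.Pointwise.Properties as Pointwise
  open import Data.List.Relation.Unary.All using (All)
  import Data.List.Relation.Unary.All.Properties as All
  open import Data.List.Relation.Unary.Any using (index)
  open import Data.List.Relation.Unary.Any.Properties using (lookup-index)
  import Data.List.Relation.Unary.Unique.Propositional.Properties as Unique
  open import Data.Rational using (_*_; _≤_; _<_; -_)
  open import Data.Rational.Properties using (_<?_)

  -- C_{2μ+1} ∨ C_{2ν+3}, with m = suc m′ and ℓ = suc (suc l) as in `Circulations`.
  m′ l : ℕ
  m′ = μ ℕ.+ μ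
  l  = ν ℕ.+ suc ν

  E : List (ℕ × ℕ)
  E = wedgeEdges (suc m′) (suc (suc l))

  n : ℕ
  n = wedgeVertices (suc m′) (suc (suc l))

  S : List (Point n)
  S = sepPoints n E

  SignPair : Set
  SignPair = List Sign × List Sign

  BalancedPair : SignPair → Set
  BalancedPair (c₁ , c₂) = c₁ ∈ₗ signVectors μ μ 1 × c₂ ∈ₗ signVectors (suc ν) (suc ν) 1

  balancedPairs : List SignPair
  balancedPairs = cartesianProduct (signVectors μ μ 1) (signVectors (suc ν) (suc ν) 1)

  face : SignPair → Subset (length S)
  face (c₁ , c₂) = signFace E (c₁ ++ c₂)

  realizer : {(c₁ , c₂) : SignPair} → BalancedPair (c₁ , c₂) →
    Σ (Point n) λ a → edgeValues a E ≡ map value (c₁ ++ c₂)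
  realizer {c₁ , c₂} (c₁∈ , c₂∈) = wedgePoint , trans
    (wedgePoint-edgeValues (Balanced.circulation-balanced μ c₁∈) (Balanced.circulation-balanced (suc ν) c₂∈))
    (sym (map-++ value c₁ c₂))
    where open WedgePoint m′ l (map value c₁) (map value c₂)

  proportional-wedge : {a′ : Point n} {b′ : ℚ} {(c₁ , c₂) : SignPair} → BalancedPair (c₁ , c₂) →
    Pointwise (ProportionalOffNone b′) (edgeValues a′ E) (c₁ ++ c₂) →
    Pointwise (Proportional b′) (edgeValues a′ E) (c₁ ++ c₂)
  proportional-wedge {a′} {b′} {c₁ , c₂} (c₁∈ , c₂∈) offNone =
    subst (λ V → Pointwise (Proportional b′) V (c₁ ++ c₂)) (sym split)
      (++⁺ (proportional-balanced μ (proj₂ (circulation-cycle₁ a′ m′)) c₁∈ (proj₁ halves))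
           (proportional-balanced (suc ν) (proj₂ (circulation-cycle₂ a′ m′ l)) c₂∈ (proj₂ halves)))
    where
    split : edgeValues a′ E ≡ edgeValues a′ (cycle₁ m′) ++ edgeValues a′ (cycle₂ m′ l)
    split = edgeValues-wedge a′ m′ l
    halves = Pointwise-++⁻ (edgeValues a′ (cycle₁ m′))
      (trans (proj₁ (circulation-cycle₁ a′ m′)) (sym (Balanced.length-balanced μ c₁∈)))
      (subst (λ V → Pointwise (ProportionalOffNone b′) V (c₁ ++ c₂)) split offNone)

  0<E : 0 ℕ.< length E
  0<E = subst (0 ℕ.<_) (sym (trans (cong length (wedgeEdges-cycles m′ l)) (length-++ (cycle₁ m′))))
              (subst (λ k → 0 ℕ.< k ℕ.+ length (cycle₂ m′ l)) (sym (length-cycle₁ m′)) (s≤s z≤n))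

  face-isFacet : {pr : SignPair} → BalancedPair pr → IsFacet S (face pr)
  face-isFacet {c₁ , c₂} bal = signFace-isFace E a↦c , signFace-≢⊤ E (c₁ ++ c₂) 0<E , maximal
    where
    a : Point n
    a = proj₁ (realizer bal)
    a↦c : edgeValues a E ≡ map value (c₁ ++ c₂)
    a↦c = proj₂ (realizer bal)
    maximal : ∀ H → IsFace S H → ¬ H ≡ ⊤ → face (c₁ , c₂) ⊆ H → H ≡ face (c₁ , c₂)
    maximal H H-face H≢⊤ F⊆H =
      trans H≡ (trans (levelSet-proportional S a a′ scaled (λ L≡⊤ → H≢⊤ (trans H≡ L≡⊤)))
                      (levelSet-signFace E a↦c))
      where
      supporting = isFace⇒levelSet S H-face
      a′ : Point n
      a′ = proj₁ supporting
      b′ : ℚ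
      b′ = proj₁ (proj₂ supporting)
      H≡ : H ≡ levelSet S a′ b′
      H≡ = proj₂ (proj₂ (proj₂ supporting))
      offNone : Pointwise (ProportionalOffNone b′) (edgeValues a′ E) (c₁ ++ c₂)
      offNone = signFace⊆⇒offNone E (length-realized E {a} a↦c) (λ {p} p∈F → subst (p ∈_) H≡ (F⊆H p∈F))
      scaled : ∀ p → dot a′ (lookup S p) ≡ dot a (lookup S p) * b′
      scaled = dot-proportional E a↦c (proportional-wedge bal offNone)

  facet⇒face : {F : Subset (length S)} → IsFacet S F → Σ SignPair λ pr → BalancedPair pr × F ≡ face pr
  facet⇒face {F} (F-face , F≢⊤ , maximal) =
    (c₁ , c₂) , (c₁∈ , c₂∈) , sym (maximal (face (c₁ , c₂)) (proj₁ G-facet) (proj₁ (proj₂ G-facet)) F⊆G)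
    where
    supporting = isFace⇒levelSet S F-face
    a : Point n
    a = proj₁ supporting
    b : ℚ
    b = proj₁ (proj₂ supporting)
    bounded : ∀ p → dot a (lookup S p) ≤ b
    bounded = proj₁ (proj₂ (proj₂ supporting))
    F≡ : F ≡ levelSet S a b
    F≡ = proj₂ (proj₂ (proj₂ supporting))
    b>0 : 0ℚ < b
    b>0 with 0ℚ <? b
    ... | yes 0<b = 0<b
    ... | no  0≮b = ⊥-elim (F≢⊤ (trans F≡ (levelSet-nonpositive E {a} bounded (ℚP.≮⇒≥ 0≮b))))
    V₁ V₂ : List ℚ
    V₁ = edgeValues a (cycle₁ m′)
    V₂ = edgeValues a (cycle₂ m′ l)
    split : edgeValues a E ≡ V₁ ++ V₂
    split = edgeValues-wedge a m′ l
    bounds = edgeValues-bounded E bounded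
    ≤b = All.++⁻ V₁ (subst (All (_≤ b)) split (proj₁ bounds))
    ≥-b = All.++⁻ V₁ (subst (All (λ x → - x ≤ b)) split (proj₂ bounds))
    signs₁ = compatibleSigns b>0 V₁ {μ} (circulation-cycle₁ a m′) (proj₁ ≤b) (proj₁ ≥-b)
    signs₂ = compatibleSigns b>0 V₂ {suc ν} (circulation-cycle₂ a m′ l) (proj₂ ≤b) (proj₂ ≥-b)
    c₁ = proj₁ signs₁
    c₂ = proj₁ signs₂
    c₁∈ = proj₁ (proj₂ signs₁)
    c₂∈ = proj₁ (proj₂ signs₂)
    compatible : Pointwise (Compatible b) (edgeValues a E) (c₁ ++ c₂)
    compatible = subst (λ V → Pointwise (Compatible b) V (c₁ ++ c₂)) (sym split)
                       (++⁺ (proj₂ (proj₂ signs₁)) (proj₂ (proj₂ signs₂)))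
    F⊆G : F ⊆ face (c₁ , c₂)
    F⊆G {p} p∈F = levelSet⊆signFace E compatible (subst (p ∈_) F≡ p∈F)
    G-facet = face-isFacet {c₁ , c₂} (c₁∈ , c₂∈)

  face-injective : {pr pr′ : SignPair} → BalancedPair pr → BalancedPair pr′ → face pr ≡ face pr′ → pr ≡ pr′
  face-injective {c₁ , c₂} {c₁′ , c₂′} bal bal′ same =
    cong₂ _,_ (Pointwise-≡⇒≡ (proj₁ halves)) (Pointwise-≡⇒≡ (proj₂ halves))
    where
    c≡c′ : c₁ ++ c₂ ≡ c₁′ ++ c₂′
    c≡c′ = signFace-injective E (length-realized E {proj₁ (realizer bal)} (proj₂ (realizer bal)))
                                (length-realized E {proj₁ (realizer bal′)} (proj₂ (realizer bal′))) same
    halves = Pointwise-++⁻ c₁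
      (trans (Balanced.length-balanced μ (proj₁ bal)) (sym (Balanced.length-balanced μ (proj₁ bal′))))
      (subst (Pointwise _≡_ (c₁ ++ c₂)) c≡c′ (Pointwise.refl refl))

  numFacets-wedge : {k : ℕ} → NumFacets S k → k ≡ balancedCount μ ℕ.* balancedCount (suc ν)
  numFacets-wedge {k} (f , f-injective , f-facet , f-onto) =
    trans (ℕP.≤-antisym facets≤pairs pairs≤facets) (length-cartesianProduct (signVectors μ μ 1) _)
    where
    classify : ∀ i → Σ SignPair λ pr → BalancedPair pr × f i ≡ face pr
    classify i = facet⇒face (f-facet i)
    member : ∀ i → proj₁ (classify i) ∈ₗ balancedPairs
    member i = ∈-cartesianProduct⁺ (proj₁ (proj₁ (proj₂ (classify i)))) (proj₂ (proj₁ (proj₂ (classify i))))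
    pairIndex : Fin k → Fin (length balancedPairs)
    pairIndex i = index (member i)
    facets≤pairs : k ℕ.≤ length balancedPairs
    facets≤pairs = injective⇒≤ {f = pairIndex} λ {i} {j} same → f-injective (begin
      f i                        ≡⟨ proj₂ (proj₂ (classify i)) ⟩
      face (proj₁ (classify i))
        ≡⟨ cong face (trans (lookup-index (member i))
                            (trans (cong (lookup balancedPairs) same) (sym (lookup-index (member j))))) ⟩
      face (proj₁ (classify j))  ≡⟨ proj₂ (proj₂ (classify j)) ⟨
      f j                        ∎)
      where open ≡-Reasoning
    balanced : ∀ i → BalancedPair (lookup balancedPairs i)
    balanced i = ∈-cartesianProduct⁻ (signVectors μ μ 1) _ (∈-lookup i)
    facetIndex : Fin (length balancedPairs) → Fin k
    facetIndex i = proj₁ (f-onto (face (lookup balancedPairs i)) (face-isFacet (balanced i)))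
    pairs≤facets : length balancedPairs ℕ.≤ k
    pairs≤facets = injective⇒≤ {f = facetIndex} λ {i} {j} same →
      lookup-injective
        (Unique.cartesianProduct⁺ (signVectors-unique μ μ 1) (signVectors-unique (suc ν) (suc ν) 1)) i j
        (face-injective (balanced i) (balanced j)
          (trans (sym (proj₂ (f-onto _ _))) (trans (cong f same) (proj₂ (f-onto _ _)))))

open BalancedCount using (balancedCount; balancedCount-*-<)

open import Data.Nat using (_+_; _*_; _%_; _/_; _≤_; _<_)
open import Data.Nat.DivMod using (m≡m%n+[m/n]*n)
open import Data.Nat.Properties using (+-mono-<; +-mono-≤; ≰⇒>; ≮⇒≥; <⇒≱; *-cancelʳ-≡; suc-injective; <-≤-trans)
open import Data.Nat.Tactic.RingSolver using (solve-∀)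

odd⇒double+1 : ∀ x → x % 2 ≡ 1 → Σ ℕ λ k → x ≡ suc (k + k)
odd⇒double+1 x x%2≡1 = x / 2 , trans (m≡m%n+[m/n]*n x 2) (trans (cong (_+ (x / 2) * 2) x%2≡1) (shape (x / 2)))
  where
  shape : ∀ k → 1 + k * 2 ≡ suc (k + k)
  shape = solve-∀

double-<-reflect : ∀ {x y} → suc (x + x) < suc (y + y) → x < y
double-<-reflect 2x+1<2y+1 = ≰⇒> λ y≤x → <⇒≱ 2x+1<2y+1 (s≤s (+-mono-≤ y≤x y≤x))

double-≤-reflect : ∀ {x y} → suc (x + x) ≤ suc (y + y) → x ≤ y
double-≤-reflect 2x+1≤2y+1 = ≮⇒≥ λ y<x → <⇒≱ (s≤s (+-mono-< y<x y<x)) 2x+1≤2y+1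

double-+-reflect : ∀ {x y u v} → suc (x + x) + suc (y + y) ≡ suc (u + u) + suc (v + v) → x + y ≡ u + v
double-+-reflect {x} {y} {u} {v} eq =
  *-cancelʳ-≡ (x + y) (u + v) 2 (suc-injective (suc-injective (trans (sym (shape x y)) (trans eq (shape u v)))))
  where
  shape : ∀ x y → suc (x + x) + suc (y + y) ≡ suc (suc ((x + y) * 2))
  shape = solve-∀

numFacets-wedge-< : ∀ {μ ν α β a b} → μ < α → α ≤ β → β < ν → α + β ≡ μ + ν →
  NumFacets (wedgePoints (suc (μ + μ)) (suc (ν + ν))) a →
  NumFacets (wedgePoints (suc (α + α)) (suc (β + β))) b → a < b
numFacets-wedge-< {ν = zero}  _   _   ()
numFacets-wedge-< {β = zero}  μ<α α≤0 with <-≤-trans μ<α α≤0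
... | ()
numFacets-wedge-< {μ} {suc ν} {α} {suc β} {a} {b} μ<α α≤β _ α+β≡μ+ν Na Nb = begin-strict
  a                                         ≡⟨ WedgeFacets.numFacets-wedge μ ν Na ⟩
  balancedCount μ * balancedCount (suc ν)   <⟨ balancedCount-*-< μ<α α≤β α+β≡μ+ν ⟩
  balancedCount α * balancedCount (suc β)   ≡⟨ WedgeFacets.numFacets-wedge α β Nb ⟨
  b                                         ∎
  where open ℕP.≤-Reasoning

lemma3p7 : (i j m ℓ : ℕ) →
    i % 2 ≡ 1 → j % 2 ≡ 1 → m % 2 ≡ 1 → ℓ % 2 ≡ 1 →
    3 ≤ m → m < i → i ≤ j → j < ℓ → i + j ≡ m + ℓ →
    (a b : ℕ) → NumFacets (wedgePoints m ℓ) a → NumFacets (wedgePoints i j) b →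
    a < b
lemma3p7 i j m ℓ i-odd j-odd m-odd ℓ-odd _ m<i i≤j j<ℓ i+j≡m+ℓ a b Na Nb
  with odd⇒double+1 m m-odd | odd⇒double+1 ℓ ℓ-odd | odd⇒double+1 i i-odd | odd⇒double+1 j j-odd
... | μ , refl | ν , refl | α , refl | β , refl =
  numFacets-wedge-< {μ} {ν} {α} {β} {a} {b} (double-<-reflect {μ} {α} m<i) (double-≤-reflect {α} {β} i≤j)
    (double-<-reflect {β} {ν} j<ℓ) (double-+-reflect {α} {β} {μ} {ν} i+j≡m+ℓ) Na Nb
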